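{- Let $k,g,\lambda$ be integers such that a $vgr(n,k,g,\lambda)$-graph exists, where $g$ is even. If $g\equiv 0 \pmod 4$, then $$n(k,g,\lambda)\ge\frac{c(g,k)+2\lambda+k^{g}-2c(\tfrac{g}{2},k)k^{\frac{g}{2}}}{c(g,k)-c(\tfrac{g}{2},k)^2+2\lambda},\qquad n_2(k,g,\lambda)\ge2\,\frac{c(g,k)+2\lambda+k^{g}-2c(\tfrac{g}{2},k)k^{\frac{g}{2}}}{c(g,k)-c(\tfrac{g}{2},k)^2+2\lambda}.$$ If $g\equiv 2 \pmod 4$, then $$n(k,g,\lambda)\ge\frac{c(g,k)+2\lambda+k^g}{c(g,k)+2\lambda},\qquad n_2(k,g,\lambda)\ge\frac{2k^g}{c(g,k)+2\lambda}.$$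
   Context: A $vgr(n,k,g,\lambda)$-graph is a $k$-regular graph of girth $g$ on $n$ vertices in which every vertex is contained in exactly $\lambda$ cycles of length $g$. $n(k,g,\lambda)$ is the smallest integer $v$ such that a $vgr(v,k,g,\lambda)$-graph exists, and $n_2(k,g,\lambda)$ is the smallest integer $v$ such that a bipartite $vgr(v,k,g,\lambda)$-graph exists ($\infty$ if none exists). For a positive integer $\ell$, $c(\ell,k)$ denotes the number of closed walks of length $\ell$ starting and ending at a fixed vertex of the infinite $k$-regular tree (equivalently, the number of closed walks of length $\ell\le g$ at any vertex of a $k$-regular graph of girth $g$ that do not traverse a cycle); e.g. $c(2,k)=k$, $c(4,k)=2k^2-k$, and $c(\ell,k)=0$ for $\ell$ odd. -}

module Defs where

open import Data.Nat using (ℕ; zero; suc; _+_; _*_; _∸_; _≤_; _<_)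
import Data.Nat
open import Data.Bool using (Bool; true; false; not; _∧_; _∨_; if_then_else_)
open import Data.Fin using (Fin)
open import Data.Fin.Properties using (_≟_)
open import Data.List using (List; []; _∷_; map; concatMap; allFin)
open import Data.Nat.ListAction using (sum)
open import Data.Product using (Σ; ∃; _×_)
open import Relation.Nullary.Decidable using (⌊_⌋)
open import Relation.Binary.PropositionalEquality using (_≡_; _≢_)

-- Closed walks in the infinite k-regular tree.
-- treeWalks k ℓ d = number of walks of length ℓ in the infinite
-- k-regular tree that start at a vertex at distance d from a fixed
-- root r and end at r.  (From the root there are k edges, all leading
-- to distance 1; from a vertex at distance d+1 there is one edge back
-- to distance d and k-1 edges to distance d+2.)
treeWalks : ℕ → ℕ → ℕ → ℕ
treeWalks k zero    zero    = 1
treeWalks k zero    (suc d) = 0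
treeWalks k (suc ℓ) zero    = k * treeWalks k ℓ 1
treeWalks k (suc ℓ) (suc d) = treeWalks k ℓ d + (k ∸ 1) * treeWalks k ℓ (suc (suc d))

c : ℕ → ℕ → ℕ
c ℓ k = treeWalks k ℓ 0

record Graph (n : ℕ) : Set where
  field
    adj     : Fin n → Fin n → Bool
    sym     : ∀ u v → adj u v ≡ adj v u
    irrefl  : ∀ v → adj v v ≡ false
open Graph public

count : {A : Set} → (A → Bool) → List A → ℕ
count p xs = sum (map (λ x → if p x then 1 else 0) xs)

degree : ∀ {n} → Graph n → Fin n → ℕ
degree {n} G v = count (adj G v) (allFin n)

allLists : (n ℓ : ℕ) → List (List (Fin n))
allLists n zero    = [] ∷ []
allLists n (suc ℓ) = concatMap (λ x → map (x ∷_) (allLists n ℓ)) (allFin n)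

eqᵇ : ∀ {n} → Fin n → Fin n → Bool
eqᵇ x y = ⌊ x ≟ y ⌋

anyᵇ : {A : Set} → (A → Bool) → List A → Bool
anyᵇ p []       = false
anyᵇ p (x ∷ xs) = p x ∨ anyᵇ p xs

allDistinct : ∀ {n} → List (Fin n) → Bool
allDistinct []       = true
allDistinct (x ∷ xs) = not (anyᵇ (eqᵇ x) xs) ∧ allDistinct xs

pathBackTo : ∀ {n} → Graph n → Fin n → List (Fin n) → Bool
pathBackTo G first []           = false
pathBackTo G first (x ∷ [])     = adj G x first
pathBackTo G first (x ∷ y ∷ xs) = adj G x y ∧ pathBackTo G first (y ∷ xs)

isCycleSeq : ∀ {n} → Graph n → List (Fin n) → Bool
isCycleSeq G []       = false
isCycleSeq G (v ∷ xs) = allDistinct (v ∷ xs) ∧ pathBackTo G v (v ∷ xs)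

-- For ℓ ≥ 3 every ℓ-cycle through v is counted
-- exactly twice (once per direction), so this equals 2·(#ℓ-cycles through v).
rootedCycleSeqs : ∀ {n} → Graph n → Fin n → ℕ → ℕ
rootedCycleSeqs {n} G v ℓ = count (λ xs → isCycleSeq G (v ∷ xs)) (allLists n (ℓ ∸ 1))

cyclesThrough : ∀ {n} → Graph n → Fin n → ℕ → ℕ
cyclesThrough G v ℓ = Data.Nat._/_ (rootedCycleSeqs G v ℓ) 2

Regular : ∀ {n} → Graph n → ℕ → Set
Regular G k = ∀ v → degree G v ≡ k

HasGirth : ∀ {n} → Graph n → ℕ → Set
HasGirth {n} G g =
  (3 ≤ g)
  × (∀ ℓ → 3 ≤ ℓ → ℓ < g → ∀ v → cyclesThrough G v ℓ ≡ 0)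
  × (Σ (Fin n) λ v → cyclesThrough G v g ≢ 0)

IsVGR : ∀ {n} → Graph n → ℕ → ℕ → ℕ → Set
IsVGR G k g λ′ = Regular G k × HasGirth G g × (∀ v → cyclesThrough G v g ≡ λ′)

Bipartite : ∀ {n} → Graph n → Set
Bipartite {n} G = Σ (Fin n → Bool) λ col →
  ∀ u v → adj G u v ≡ true → col u ≢ col v

-- Let A be the adjacency matrix, Aⱼ the matrix counting non-backtracking walks of length j,
-- h = g/2 and u a vertex. Every walk is a non-backtracking walk decorated with tree excursions:
-- A^ℓ = ∑ⱼ t(ℓ,j) Aⱼ with t(ℓ,j) = treeWalks k ℓ j, so t(ℓ,0) = c(ℓ,k). Below the girth the only
-- closed non-backtracking walk is the trivial one, and those of length g at u are the 2λ oriented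
-- g-cycles through u; hence (A^ℓ)ᵤᵤ = c(ℓ,k) for ℓ < g and (A^g)ᵤᵤ = c(g,k) + 2λ. The row x of A^h
-- at u therefore has ∑ x = k^h, ∑ x² = (A^g)ᵤᵤ and xᵤ = c(h,k), which vanishes for odd h.
-- Cauchy–Schwarz over the other vertices, (∑ x − xᵤ)² ≤ (n − 1)(∑ x² − xᵤ²), is the bound;
-- in a bipartite graph x lives on one colour class, which has n/2 vertices.
module Submission where

open import Defs renaming (sym to adj-sym)

module Counting where

  open import Data.Bool using (Bool; true; false; not; _∧_; _∨_; if_then_else_)
  import Data.Bool.Properties as Bool
  open import Data.Bool.Properties
    using ( ∧-identityʳ; ∧-zeroʳ; ∧-conicalˡ; ∧-conicalʳ; ∧-comm; ∧-assoc
          ; ∨-identityʳ; ∨-zeroʳ; ∨-conicalˡ; ∨-conicalʳ; ∨-comm; ∨-assoc; not-involutive; ¬-not; ⇔→≡)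
  open import Data.Empty using (⊥; ⊥-elim)
  open import Data.Fin using (Fin; zero; suc; toℕ)
  open import Data.Fin.Properties using (_≟_) renaming (suc-injective to Fin-suc-injective)
  import Data.Fin.Properties as Fin
  open import Data.List using (List; []; _∷_; _++_; map; allFin; tabulate; concatMap; reverse; length; head)
  open import Data.Maybe using (Maybe; just; nothing; fromMaybe)
  open import Data.List.Properties
    using (map-tabulate; map-cong; unfold-reverse; reverse-involutive; reverse-++; ++-assoc; length-++)
  open import Data.List.Relation.Binary.Pointwise using (Pointwise-≡⇒≡)
  import Data.List.Relation.Binary.Lex.Strict as Lex
  import Data.Nat.ListAction as List
  open import Data.Nat hiding (_≟_)
  open import Data.Nat.Properties hiding (_≟_)
  open import Algebra.Properties.Semiring.Sum +-*-semiring
    using (sum; sum-syntax; sum-cong-≗; sum-replicate-zero; sum-init-last; ∑-distrib-+; ∑-comm; *-distribˡ-sum; *-distribʳ-sum)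
  open import Data.Nat.DivMod using (m*n/n≡m; m≡m%n+[m/n]*n)
  open import Data.Nat.Tactic.RingSolver using (solve-∀)
  open import Data.Product using (Σ-syntax; _×_; _,_; proj₁; proj₂)
  open import Data.Sum using ([_,_]′)
  open import Function using (_∘_; id; mk⇔)
  open import Relation.Binary.PropositionalEquality
  open import Relation.Binary using (StrictTotalOrder; Tri; tri<; tri≈; tri>)
  open import Relation.Nullary using (yes; no; does)
  open import Relation.Nullary.Decidable using (dec-true; dec-false; isYes≗does)

  ⟦_⟧ : Bool → ℕ
  ⟦ b ⟧ = if b then 1 else 0

  true≢false : true ≢ false
  true≢false ()

  ⟦⟧-idem : ∀ b → ⟦ b ⟧ * ⟦ b ⟧ ≡ ⟦ b ⟧
  ⟦⟧-idem true  = refl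
  ⟦⟧-idem false = refl

  eqᵇ-refl : ∀ {n} (x : Fin n) → eqᵇ x x ≡ true
  eqᵇ-refl x = trans (isYes≗does (x ≟ x)) (dec-true (x ≟ x) refl)

  eqᵇ-≢ : ∀ {n} {x y : Fin n} → x ≢ y → eqᵇ x y ≡ false
  eqᵇ-≢ {x = x} {y} x≢y = trans (isYes≗does (x ≟ y)) (dec-false (x ≟ y) x≢y)

  eqᵇ-sound : ∀ {n} {x y : Fin n} → eqᵇ x y ≡ true → x ≡ y
  eqᵇ-sound {x = x} {y} e with x ≟ y
  ... | yes p = p
  eqᵇ-sound () | no _

  eqᵇ-sym : ∀ {n} (x y : Fin n) → eqᵇ x y ≡ eqᵇ y x
  eqᵇ-sym x y with x ≟ y
  ... | yes refl = sym (eqᵇ-refl x)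
  ... | no x≢y   = sym (eqᵇ-≢ (x≢y ∘ sym))

  sum-zero : ∀ {n} {f : Fin n → ℕ} → (∀ i → f i ≡ 0) → sum f ≡ 0
  sum-zero {n} f≗0 = trans (sum-cong-≗ f≗0) (sum-replicate-zero n)

  sum-single : ∀ {n} (f : Fin n → ℕ) v → (∀ i → i ≢ v → f i ≡ 0) → sum f ≡ f v
  sum-single f zero    f≗0 = trans (cong (f zero +_) (sum-zero (λ i → f≗0 (suc i) λ ()))) (+-identityʳ _)
  sum-single f (suc v) f≗0 =
    cong₂ _+_ (f≗0 zero λ ()) (sum-single (f ∘ suc) v (λ i i≢v → f≗0 (suc i) (i≢v ∘ Fin-suc-injective)))

  sum-δ : ∀ {n} (v : Fin n) (f : Fin n → ℕ) → ∑[ i < n ] (⟦ eqᵇ v i ⟧ * f i) ≡ f v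
  sum-δ v f = trans (sum-single _ v (λ i i≢v → cong (λ b → ⟦ b ⟧ * f i) (eqᵇ-≢ (i≢v ∘ sym))))
                    (trans (cong (λ b → ⟦ b ⟧ * f v) (eqᵇ-refl v)) (+-identityʳ (f v)))

  sum-δ′ : ∀ {n} (v : Fin n) (f : Fin n → ℕ) → ∑[ i < n ] (⟦ eqᵇ i v ⟧ * f i) ≡ f v
  sum-δ′ v f = trans (sum-cong-≗ λ i → cong (λ b → ⟦ b ⟧ * f i) (eqᵇ-sym i v)) (sum-δ v f)

  sum-mono-≤ : ∀ {n} {f g : Fin n → ℕ} → (∀ i → f i ≤ g i) → sum f ≤ sum g
  sum-mono-≤ {zero}  f≤g = z≤n
  sum-mono-≤ {suc n} f≤g = +-mono-≤ (f≤g zero) (sum-mono-≤ (f≤g ∘ suc))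

  term≤sum : ∀ {n} (f : Fin n → ℕ) v → f v ≤ sum f
  term≤sum f zero    = m≤m+n _ _
  term≤sum f (suc v) = ≤-trans (term≤sum (f ∘ suc) v) (m≤n+m _ _)

  sum-ones : ∀ n → ∑[ i < n ] 1 ≡ n
  sum-ones zero    = refl
  sum-ones (suc n) = cong suc (sum-ones n)

  sum-* : ∀ {n} (f g : Fin n → ℕ) → sum f * sum g ≡ ∑[ i < n ] ∑[ j < n ] (f i * g j)
  sum-* f g = trans (*-distribʳ-sum (sum g) f) (sum-cong-≗ λ i → *-distribˡ-sum (f i) g)

  2ab≤a²+b² : ∀ a b → 2 * (a * b) ≤ a * a + b * b
  2ab≤a²+b² a b = [ ordered , flipped ]′ (≤-total a b)
    where
    gap : ∀ a d → a * a + (a + d) * (a + d) ≡ 2 * (a * (a + d)) + d * d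
    gap = solve-∀
    ordered : ∀ {a b} → a ≤ b → 2 * (a * b) ≤ a * a + b * b
    ordered {a} a≤b with m≤n⇒∃[o]m+o≡n a≤b
    ... | d , refl = subst (2 * (a * (a + d)) ≤_) (sym (gap a d)) (m≤m+n _ _)
    flipped : b ≤ a → 2 * (a * b) ≤ a * a + b * b
    flipped b≤a = subst₂ _≤_ (cong (2 *_) (*-comm b a)) (+-comm (b * b) (a * a)) (ordered b≤a)

  cauchy-schwarz : ∀ {n} (w x : Fin n → ℕ) →
    (∑[ i < n ] (w i * x i)) * (∑[ i < n ] (w i * x i)) ≤ sum w * ∑[ i < n ] (w i * (x i * x i))
  cauchy-schwarz {n} w x = *-cancelˡ-≤ 2 (subst₂ _≤_ (sym lhs) (sym rhs) (sum-mono-≤ λ i → sum-mono-≤ λ j → pair i j))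
    where
    open ≡-Reasoning
    F : Fin n → ℕ
    F i = w i * x i
    U : Fin n → Fin n → ℕ
    U i j = w i * (w j * (x j * x j))
    -- 2 (wᵢxᵢ)(wⱼxⱼ) ≤ wᵢwⱼ(xᵢ² + xⱼ²), summed over all pairs.
    pair : ∀ i j → 2 * (F i * F j) ≤ U i j + U j i
    pair i j = subst₂ _≤_ (scaleˡ (w i) (w j) (x i) (x j)) (scaleʳ (w i) (w j) (x i) (x j))
                          (*-monoʳ-≤ (w i * w j) (2ab≤a²+b² (x i) (x j)))
      where
      scaleˡ : ∀ a b c d → (a * b) * (2 * (c * d)) ≡ 2 * ((a * c) * (b * d))
      scaleˡ = solve-∀
      scaleʳ : ∀ a b c d → (a * b) * (c * c + d * d) ≡ a * (b * (d * d)) + b * (a * (c * c))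
      scaleʳ = solve-∀
    lhs : 2 * (sum F * sum F) ≡ ∑[ i < n ] ∑[ j < n ] (2 * (F i * F j))
    lhs = trans (cong (2 *_) (sum-* F F))
                (trans (*-distribˡ-sum 2 (λ i → ∑[ j < n ] (F i * F j))) (sum-cong-≗ λ i → *-distribˡ-sum 2 (λ j → F i * F j)))
    rhs : 2 * (sum w * ∑[ i < n ] (w i * (x i * x i))) ≡ ∑[ i < n ] ∑[ j < n ] (U i j + U j i)
    rhs = begin
      2 * R
        ≡⟨ cong (R +_) (+-identityʳ R) ⟩
      R + R
        ≡⟨ cong₂ _+_ R≡ (trans R≡ (∑-comm U)) ⟩
      ∑[ i < n ] ∑[ j < n ] U i j + ∑[ i < n ] ∑[ j < n ] U j i
        ≡⟨ ∑-distrib-+ (λ i → ∑[ j < n ] U i j) (λ i → ∑[ j < n ] U j i) ⟨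
      ∑[ i < n ] (∑[ j < n ] U i j + ∑[ j < n ] U j i)
        ≡⟨ sum-cong-≗ (λ i → ∑-distrib-+ (U i) (λ j → U j i)) ⟨
      ∑[ i < n ] ∑[ j < n ] (U i j + U j i) ∎
      where
      R : ℕ
      R = sum w * ∑[ i < n ] (w i * (x i * x i))
      R≡ : R ≡ ∑[ i < n ] ∑[ j < n ] U i j
      R≡ = sum-* w (λ i → w i * (x i * x i))

  sum-allFin : ∀ {n} (f : Fin n → ℕ) → List.sum (map f (allFin n)) ≡ sum f
  sum-allFin {n} f = trans (cong List.sum (map-tabulate id f)) (sum-tabulate f)
    where
    sum-tabulate : ∀ {n} (f : Fin n → ℕ) → List.sum (tabulate f) ≡ sum f
    sum-tabulate {zero}  f = refl
    sum-tabulate {suc n} f = cong (f zero +_) (sum-tabulate (f ∘ suc))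

  count-allFin : ∀ {n} (p : Fin n → Bool) → count p (allFin n) ≡ ∑[ i < n ] ⟦ p i ⟧
  count-allFin p = sum-allFin (λ i → ⟦ p i ⟧)

  module _ {A : Set} where

    count-++ : ∀ (q : A → Bool) xs ys → count q (xs ++ ys) ≡ count q xs + count q ys
    count-++ q []       ys = refl
    count-++ q (x ∷ xs) ys = trans (cong (⟦ q x ⟧ +_) (count-++ q xs ys)) (sym (+-assoc ⟦ q x ⟧ _ _))

    count-map : ∀ {B : Set} (q : A → Bool) (f : B → A) xs → count q (map f xs) ≡ count (q ∘ f) xs
    count-map q f []       = refl
    count-map q f (x ∷ xs) = cong (⟦ q (f x) ⟧ +_) (count-map q f xs)

    count-cong : ∀ {q q′ : A → Bool} xs → (∀ x → q x ≡ q′ x) → count q xs ≡ count q′ xs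
    count-cong []       q≗q′ = refl
    count-cong (x ∷ xs) q≗q′ = cong₂ _+_ (cong ⟦_⟧ (q≗q′ x)) (count-cong xs q≗q′)

    count-const-∧ : ∀ b (q : A → Bool) xs → count (λ x → b ∧ q x) xs ≡ ⟦ b ⟧ * count q xs
    count-const-∧ true  q xs = sym (+-identityʳ _)
    count-const-∧ false q []       = refl
    count-const-∧ false q (_ ∷ xs) = count-const-∧ false q xs

    count-concatMap : ∀ {B : Set} (q : A → Bool) (f : B → List A) xs →
      count q (concatMap f xs) ≡ List.sum (map (λ x → count q (f x)) xs)
    count-concatMap q f []       = refl
    count-concatMap q f (x ∷ xs) = trans (count-++ q (f x) (concatMap f xs)) (cong (count q (f x) +_) (count-concatMap q f xs))

  module Sequences (n : ℕ) where

    #[_]_ : (List (Fin n) → Bool) → ℕ → ℕ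
    #[ q ] m = count q (allLists n m)

    #-cons : ∀ m q → #[ q ] suc m ≡ ∑[ y < n ] #[ (λ ys → q (y ∷ ys)) ] m
    #-cons m q = begin
      count q (concatMap (λ y → map (y ∷_) (allLists n m)) (allFin n))
        ≡⟨ count-concatMap q _ (allFin n) ⟩
      List.sum (map (λ y → count q (map (y ∷_) (allLists n m))) (allFin n))
        ≡⟨ cong List.sum (map-cong (λ y → count-map q (y ∷_) (allLists n m)) (allFin n)) ⟩
      List.sum (map (λ y → #[ (λ ys → q (y ∷ ys)) ] m) (allFin n))
        ≡⟨ sum-allFin (λ y → #[ (λ ys → q (y ∷ ys)) ] m) ⟩
      ∑[ y < n ] #[ (λ ys → q (y ∷ ys)) ] m ∎
      where open ≡-Reasoning

    #-cong : ∀ m {q q′} → (∀ xs → length xs ≡ m → q xs ≡ q′ xs) → #[ q ] m ≡ #[ q′ ] m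
    #-cong zero    q≗q′ = cong (_+ 0) (cong ⟦_⟧ (q≗q′ [] refl))
    #-cong (suc m) {q} {q′} q≗q′ =
      trans (#-cons m q) (trans (sum-cong-≗ λ y → #-cong m (λ xs e → q≗q′ (y ∷ xs) (cong suc e))) (sym (#-cons m q′)))

    #-zero : ∀ m q → (∀ xs → length xs ≡ m → q xs ≡ false) → #[ q ] m ≡ 0
    #-zero zero    q q≗f = cong (λ b → ⟦ b ⟧ + 0) (q≗f [] refl)
    #-zero (suc m) q q≗f = trans (#-cons m q) (sum-zero λ y → #-zero m _ λ xs e → q≗f (y ∷ xs) (cong suc e))

    #-pos : ∀ q xs → q xs ≡ true → 1 ≤ #[ q ] length xs
    #-pos q []       qxs = subst (λ b → 1 ≤ ⟦ b ⟧ + 0) (sym qxs) ≤-refl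
    #-pos q (x ∷ xs) qxs = subst (1 ≤_) (sym (#-cons (length xs) q))
      (≤-trans (#-pos (λ ys → q (x ∷ ys)) xs qxs) (term≤sum (λ y → #[ (λ ys → q (y ∷ ys)) ] length xs) x))

    #-snoc : ∀ m q → #[ q ] suc m ≡ ∑[ y < n ] #[ (λ ys → q (ys ++ y ∷ [])) ] m
    #-snoc zero    q = #-cons 0 q
    #-snoc (suc m) q = begin
      #[ q ] suc (suc m)                                              ≡⟨ #-cons (suc m) q ⟩
      ∑[ x < n ] #[ (λ ys → q (x ∷ ys)) ] suc m                       ≡⟨ sum-cong-≗ (λ x → #-snoc m (λ ys → q (x ∷ ys))) ⟩
      ∑[ x < n ] ∑[ y < n ] #[ (λ ys → q (x ∷ ys ++ y ∷ [])) ] m      ≡⟨ ∑-comm (λ x y → #[ (λ ys → q (x ∷ ys ++ y ∷ [])) ] m) ⟩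
      ∑[ y < n ] ∑[ x < n ] #[ (λ ys → q (x ∷ ys ++ y ∷ [])) ] m      ≡⟨ sum-cong-≗ (λ y → #-cons m (λ zs → q (zs ++ y ∷ []))) ⟨
      ∑[ y < n ] #[ (λ ys → q (ys ++ y ∷ [])) ] suc m                 ∎
      where open ≡-Reasoning

    #-reverse : ∀ m q → #[ q ∘ reverse ] m ≡ #[ q ] m
    #-reverse zero    q = refl
    #-reverse (suc m) q = begin
      #[ q ∘ reverse ] suc m
        ≡⟨ #-cons m (q ∘ reverse) ⟩
      ∑[ x < n ] #[ (λ ys → q (reverse (x ∷ ys))) ] m
        ≡⟨ sum-cong-≗ (λ x → count-cong (allLists n m) (λ ys → cong q (unfold-reverse x ys))) ⟩
      ∑[ x < n ] #[ (λ ys → q (reverse ys ++ x ∷ [])) ] m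
        ≡⟨ sum-cong-≗ (λ x → #-reverse m (λ zs → q (zs ++ x ∷ []))) ⟩
      ∑[ x < n ] #[ (λ ys → q (ys ++ x ∷ [])) ] m
        ≡⟨ #-snoc m q ⟨
      #[ q ] suc m ∎
      where open ≡-Reasoning

    #-split : ∀ m q Q Q′ → (∀ xs → length xs ≡ m → ⟦ q xs ⟧ ≡ ⟦ Q xs ⟧ + ⟦ Q′ xs ⟧) → #[ q ] m ≡ #[ Q ] m + #[ Q′ ] m
    #-split zero    q Q Q′ split = trans (+-identityʳ ⟦ q [] ⟧)
      (trans (split [] refl) (sym (cong₂ _+_ (+-identityʳ ⟦ Q [] ⟧) (+-identityʳ ⟦ Q′ [] ⟧))))
    #-split (suc m) q Q Q′ split = begin
      #[ q ] suc m
        ≡⟨ #-cons m q ⟩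
      ∑[ y < n ] #[ (λ ys → q (y ∷ ys)) ] m
        ≡⟨ sum-cong-≗ (λ y → #-split m _ _ _ (λ xs e → split (y ∷ xs) (cong suc e))) ⟩
      ∑[ y < n ] (#[ (λ ys → Q (y ∷ ys)) ] m + #[ (λ ys → Q′ (y ∷ ys)) ] m)
        ≡⟨ ∑-distrib-+ (λ y → #[ (λ ys → Q (y ∷ ys)) ] m) (λ y → #[ (λ ys → Q′ (y ∷ ys)) ] m) ⟩
      ∑[ y < n ] #[ (λ ys → Q (y ∷ ys)) ] m + ∑[ y < n ] #[ (λ ys → Q′ (y ∷ ys)) ] m
        ≡⟨ cong₂ _+_ (#-cons m Q) (#-cons m Q′) ⟨
      #[ Q ] suc m + #[ Q′ ] suc m ∎
      where open ≡-Reasoning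

    open StrictTotalOrder (Lex.<-strictTotalOrder (Fin.<-strictTotalOrder n))
      using (asym) renaming (compare to compareˡ; _<?_ to _<ˡ?_)

    precedes : List (Fin n) → List (Fin n) → Bool
    precedes xs ys = does (xs <ˡ? ys)

    precedes-trichotomy : ∀ xs ys → xs ≢ ys → ⟦ precedes xs ys ⟧ + ⟦ precedes ys xs ⟧ ≡ 1
    precedes-trichotomy xs ys xs≢ys = from-tri (compareˡ xs ys)
      where
      from-tri : Tri _ _ _ → ⟦ precedes xs ys ⟧ + ⟦ precedes ys xs ⟧ ≡ 1
      from-tri (tri< xs<ys _ _) =
        cong₂ _+_ (cong ⟦_⟧ (dec-true (xs <ˡ? ys) xs<ys)) (cong ⟦_⟧ (dec-false (ys <ˡ? xs) (asym xs<ys)))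
      from-tri (tri≈ _ xs≋ys _) = ⊥-elim (xs≢ys (Pointwise-≡⇒≡ xs≋ys))
      from-tri (tri> _ _ ys<xs) =
        cong₂ _+_ (cong ⟦_⟧ (dec-false (xs <ˡ? ys) (asym ys<xs))) (cong ⟦_⟧ (dec-true (ys <ˡ? xs) ys<xs))

    -- Pairing each sequence with its reverse; the lexicographically smaller one represents the pair.
    #-even : ∀ m q → (∀ xs → q (reverse xs) ≡ q xs) → (∀ xs → length xs ≡ m → q xs ≡ true → reverse xs ≢ xs) →
      #[ q ] m ≡ 2 * #[ (λ xs → q xs ∧ precedes xs (reverse xs)) ] m
    #-even m q q-rev no-palindrome = begin
      #[ q ] m               ≡⟨ #-split m q Q Q′ split ⟩
      #[ Q ] m + #[ Q′ ] m   ≡⟨ cong (#[ Q ] m +_) (trans (count-cong (allLists n m) Q′≡Q∘reverse) (#-reverse m Q)) ⟩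
      #[ Q ] m + #[ Q ] m    ≡⟨ cong (#[ Q ] m +_) (+-identityʳ (#[ Q ] m)) ⟨
      2 * #[ Q ] m           ∎
      where
      open ≡-Reasoning
      Q Q′ : List (Fin n) → Bool
      Q  xs = q xs ∧ precedes xs (reverse xs)
      Q′ xs = q xs ∧ precedes (reverse xs) xs
      Q′≡Q∘reverse : ∀ xs → Q′ xs ≡ Q (reverse xs)
      Q′≡Q∘reverse xs = cong₂ _∧_ (sym (q-rev xs)) (cong (precedes (reverse xs)) (sym (reverse-involutive xs)))
      split : ∀ xs → length xs ≡ m → ⟦ q xs ⟧ ≡ ⟦ Q xs ⟧ + ⟦ Q′ xs ⟧
      split xs len with q xs in qxs
      ... | false = refl
      ... | true  = sym (precedes-trichotomy xs (reverse xs) (≢-sym (no-palindrome xs len qxs)))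

  module Walks {n : ℕ} (G : Graph n) where

    A : Fin n → Fin n → ℕ
    A u v = ⟦ adj G u v ⟧

    A-sym : ∀ u v → A u v ≡ A v u
    A-sym u v = cong ⟦_⟧ (adj-sym G u v)

    degree≡sum : ∀ u → degree G u ≡ sum (A u)
    degree≡sum u = count-allFin (adj G u)

    walks : ℕ → Fin n → Fin n → ℕ
    walks zero    u v = ⟦ eqᵇ u v ⟧
    walks (suc ℓ) u v = ∑[ w < n ] (A u w * walks ℓ w v)

    walks-+ : ∀ a b u v → walks (a + b) u v ≡ ∑[ w < n ] (walks a u w * walks b w v)
    walks-+ zero    b u v = sym (sum-δ u (λ w → walks b w v))
    walks-+ (suc a) b u v = begin
      ∑[ x < n ] (A u x * walks (a + b) x v)
        ≡⟨ sum-cong-≗ (λ x → cong (A u x *_) (walks-+ a b x v)) ⟩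
      ∑[ x < n ] (A u x * ∑[ w < n ] (walks a x w * walks b w v))
        ≡⟨ sum-cong-≗ (λ x → *-distribˡ-sum (A u x) (λ w → walks a x w * walks b w v)) ⟩
      ∑[ x < n ] ∑[ w < n ] (A u x * (walks a x w * walks b w v))
        ≡⟨ ∑-comm (λ x w → A u x * (walks a x w * walks b w v)) ⟩
      ∑[ w < n ] ∑[ x < n ] (A u x * (walks a x w * walks b w v))
        ≡⟨ sum-cong-≗ {n} (λ w → sum-cong-≗ λ x → *-assoc (A u x) _ _) ⟨
      ∑[ w < n ] ∑[ x < n ] (A u x * walks a x w * walks b w v)
        ≡⟨ sum-cong-≗ (λ w → *-distribʳ-sum (walks b w v) (λ x → A u x * walks a x w)) ⟨
      ∑[ w < n ] (walks (suc a) u w * walks b w v) ∎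
      where open ≡-Reasoning

    walks-1 : ∀ u v → walks 1 u v ≡ A u v
    walks-1 u v = trans (sum-cong-≗ λ w → *-comm (A u w) _) (sum-δ′ v (A u))

    walks-sucʳ : ∀ ℓ u v → walks (suc ℓ) u v ≡ ∑[ w < n ] (walks ℓ u w * A w v)
    walks-sucʳ ℓ u v = begin
      walks (suc ℓ) u v                        ≡⟨ cong (λ m → walks m u v) (+-comm 1 ℓ) ⟩
      walks (ℓ + 1) u v                        ≡⟨ walks-+ ℓ 1 u v ⟩
      ∑[ w < n ] (walks ℓ u w * walks 1 w v)   ≡⟨ sum-cong-≗ (λ w → cong (walks ℓ u w *_) (walks-1 w v)) ⟩
      ∑[ w < n ] (walks ℓ u w * A w v)         ∎
      where open ≡-Reasoning

    walks-sym : ∀ ℓ u v → walks ℓ u v ≡ walks ℓ v u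
    walks-sym zero    u v = cong ⟦_⟧ (eqᵇ-sym u v)
    walks-sym (suc ℓ) u v =
      trans (sum-cong-≗ λ w → trans (cong₂ _*_ (A-sym u w) (walks-sym ℓ w v)) (*-comm (A w u) _)) (sym (walks-sucʳ ℓ v u))

    sum-walks² : ∀ h u → ∑[ v < n ] (walks h u v * walks h u v) ≡ walks (h + h) u u
    sum-walks² h u = trans (sum-cong-≗ λ v → cong (walks h u v *_) (walks-sym h u v)) (sym (walks-+ h h u u))

    sum-walks : ∀ {k} → Regular G k → ∀ ℓ u → sum (walks ℓ u) ≡ k ^ ℓ
    sum-walks {k} reg zero    u = trans (sum-cong-≗ λ v → sym (*-identityʳ (walks zero u v))) (sum-δ u (λ _ → 1))
    sum-walks {k} reg (suc ℓ) u = begin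
      ∑[ v < n ] ∑[ w < n ] (A u w * walks ℓ w v)   ≡⟨ ∑-comm (λ w v → A u w * walks ℓ w v) ⟨
      ∑[ w < n ] ∑[ v < n ] (A u w * walks ℓ w v)   ≡⟨ sum-cong-≗ (λ w → *-distribˡ-sum (A u w) (walks ℓ w)) ⟨
      ∑[ w < n ] (A u w * sum (walks ℓ w))          ≡⟨ sum-cong-≗ (λ w → cong (A u w *_) (sum-walks reg ℓ w)) ⟩
      ∑[ w < n ] (A u w * k ^ ℓ)                    ≡⟨ *-distribʳ-sum (k ^ ℓ) (A u) ⟨
      sum (A u) * k ^ ℓ                             ≡⟨ cong (_* k ^ ℓ) (trans (sym (degree≡sum u)) (reg u)) ⟩
      k * k ^ ℓ                                     ∎
      where open ≡-Reasoning

  -- Walks in the tree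

  sumTo : ℕ → (ℕ → ℕ) → ℕ
  sumTo N f = ∑[ j < N ] f (toℕ j)

  sumTo-pad : ∀ N m f → (∀ j → N ≤ j → f j ≡ 0) → sumTo (N + m) f ≡ sumTo N f
  sumTo-pad zero    m f f≗0 = sum-zero {m} (λ j → f≗0 (toℕ j) z≤n)
  sumTo-pad (suc N) m f f≗0 = cong (f 0 +_) (sumTo-pad N m (f ∘ suc) (λ j N≤j → f≗0 (suc j) (s≤s N≤j)))

  sumTo-zero : ∀ N f → (∀ j → j < N → f j ≡ 0) → sumTo N f ≡ 0
  sumTo-zero N f f≗0 = sum-zero {N} (λ j → f≗0 (toℕ j) (Fin.toℕ<n j))

  sumTo-snoc : ∀ N f → sumTo (suc N) f ≡ sumTo N f + f N
  sumTo-snoc N f = trans (sum-init-last (λ j → f (toℕ j)))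
    (cong₂ _+_ (sum-cong-≗ {N} (λ j → cong f (Fin.toℕ-inject₁ j))) (cong f (Fin.toℕ-fromℕ N)))

  -- The number of neighbours of a tree vertex at depth d that lie at depth d + 1.
  branching : ℕ → ℕ → ℕ
  branching k zero    = k
  branching k (suc _) = k ∸ 1

  shiftʳ : (ℕ → ℕ) → ℕ → ℕ
  shiftʳ t zero    = 0
  shiftʳ t (suc j) = t j

  treeWalks-suc : ∀ k ℓ d →
    treeWalks k (suc ℓ) d ≡ shiftʳ (treeWalks k ℓ) d + branching k d * treeWalks k ℓ (suc d)
  treeWalks-suc k ℓ zero    = refl
  treeWalks-suc k ℓ (suc d) = refl

  treeWalks-beyond : ∀ k ℓ d → ℓ < d → treeWalks k ℓ d ≡ 0
  treeWalks-beyond k zero    (suc d) ℓ<d       = refl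
  treeWalks-beyond k (suc ℓ) (suc d) (s≤s ℓ<d) =
    cong₂ _+_ (treeWalks-beyond k ℓ d ℓ<d)
              (trans (cong ((k ∸ 1) *_) (treeWalks-beyond k ℓ (2 + d) (m<n⇒m<1+n (m<n⇒m<1+n ℓ<d)))) (*-zeroʳ (k ∸ 1)))

  treeWalks-diagonal : ∀ k ℓ → treeWalks k ℓ ℓ ≡ 1
  treeWalks-diagonal k zero    = refl
  treeWalks-diagonal k (suc ℓ) =
    cong₂ _+_ (treeWalks-diagonal k ℓ)
              (trans (cong ((k ∸ 1) *_) (treeWalks-beyond k ℓ (2 + ℓ) (m<n⇒m<1+n (n<1+n ℓ)))) (*-zeroʳ (k ∸ 1)))

  treeWalks-odd : ∀ k ℓ d q → ℓ + d ≡ suc (q + q) → treeWalks k ℓ d ≡ 0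
  treeWalks-odd k zero    (suc d) q e = refl
  treeWalks-odd k (suc ℓ) zero    q e =
    trans (cong (k *_) (treeWalks-odd k ℓ 1 q (trans (+-comm ℓ 1) (trans (cong suc (sym (+-identityʳ ℓ))) e)))) (*-zeroʳ k)
  treeWalks-odd k (suc ℓ) (suc d) zero    e = ⊥-elim (1+n≢0 (trans (sym (+-suc ℓ d)) (suc-injective e)))
  treeWalks-odd k (suc ℓ) (suc d) (suc q) e =
    cong₂ _+_ (treeWalks-odd k ℓ d q ℓ+d≡)
              (trans (cong ((k ∸ 1) *_) (treeWalks-odd k ℓ (2 + d) (suc q) ℓ+2+d≡)) (*-zeroʳ (k ∸ 1)))
    where
    ℓ+d≡ : ℓ + d ≡ suc (q + q)
    ℓ+d≡ = suc-injective (trans (sym (+-suc ℓ d)) (trans (suc-injective e) (cong suc (+-suc q q))))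
    ℓ+2+d≡ : ℓ + (2 + d) ≡ suc (suc q + suc q)
    ℓ+2+d≡ = trans (+-suc ℓ (suc d)) (trans (cong suc (+-suc ℓ d)) (cong (2 +_) (trans ℓ+d≡ (sym (+-suc q q)))))

  sumTo-back-steps : ∀ (μ t a : ℕ → ℕ) N → (∀ j → N ≤ j → t j ≡ 0) →
    sumTo N (λ j → t j * shiftʳ (λ i → μ i * a i) j) ≡ sumTo (suc N) (λ j → μ j * t (suc j) * a j)
  sumTo-back-steps μ t a = steps
    where
    open ≡-Reasoning
    F : ℕ → ℕ
    F j = μ j * t (suc j) * a j
    F≡0 : ∀ {j} → t (suc j) ≡ 0 → F j ≡ 0
    F≡0 {j} t≡0 = trans (cong (λ x → μ j * x * a j) t≡0) (cong (_* a j) (*-zeroʳ (μ j)))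
    reorder : ∀ x m y → x * (m * y) ≡ m * x * y
    reorder = solve-∀
    steps : ∀ N → (∀ j → N ≤ j → t j ≡ 0) → sumTo N (λ j → t j * shiftʳ (λ i → μ i * a i) j) ≡ sumTo (suc N) F
    steps zero    t≗0 = sym (sumTo-pad 0 1 F (λ j _ → F≡0 (t≗0 (suc j) z≤n)))
    steps (suc M) t≗0 = begin
      t 0 * 0 + sumTo M (λ j → t (suc j) * (μ j * a j))
        ≡⟨ cong (_+ sumTo M (λ j → t (suc j) * (μ j * a j))) (*-zeroʳ (t 0)) ⟩
      sumTo M (λ j → t (suc j) * (μ j * a j))
        ≡⟨ sum-cong-≗ {M} (λ j → reorder (t (suc (toℕ j))) (μ (toℕ j)) (a (toℕ j))) ⟩
      sumTo M F
        ≡⟨ sumTo-pad M 2 F (λ j M≤j → F≡0 (t≗0 (suc j) (s≤s M≤j))) ⟨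
      sumTo (M + 2) F
        ≡⟨ cong (λ L → sumTo L F) (+-comm M 2) ⟩
      sumTo (2 + M) F ∎

  -- One step of the tree recurrence, moved from the coefficients t onto the sequence a.
  transfer : ∀ (μ t a : ℕ → ℕ) N → (∀ j → N ≤ j → t j ≡ 0) →
    sumTo N (λ j → t j * (a (suc j) + shiftʳ (λ i → μ i * a i) j))
      ≡ sumTo (suc N) (λ j → (shiftʳ t j + μ j * t (suc j)) * a j)
  transfer μ t a N t≗0 = begin
    sumTo N (λ j → t j * (a (suc j) + shiftʳ μa j))
      ≡⟨ sum-cong-≗ {N} (λ j → *-distribˡ-+ (t (toℕ j)) _ _) ⟩
    sumTo N (λ j → t j * a (suc j) + t j * shiftʳ μa j)
      ≡⟨ ∑-distrib-+ {N} (λ j → t (toℕ j) * a (suc (toℕ j))) (λ j → t (toℕ j) * shiftʳ μa (toℕ j)) ⟩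
    sumTo N (λ j → t j * a (suc j)) + sumTo N (λ j → t j * shiftʳ μa j)
      ≡⟨ cong (sumTo N (λ j → t j * a (suc j)) +_) (sumTo-back-steps μ t a N t≗0) ⟩
    sumTo (suc N) (λ j → shiftʳ t j * a j) + sumTo (suc N) (λ j → μ j * t (suc j) * a j)
      ≡⟨ ∑-distrib-+ {suc N} (λ j → shiftʳ t (toℕ j) * a (toℕ j)) (λ j → μ (toℕ j) * t (suc (toℕ j)) * a (toℕ j)) ⟨
    sumTo (suc N) (λ j → shiftʳ t j * a j + μ j * t (suc j) * a j)
      ≡⟨ sum-cong-≗ {suc N} (λ j → *-distribʳ-+ (a (toℕ j)) (shiftʳ t (toℕ j)) (μ (toℕ j) * t (suc (toℕ j)))) ⟨
    sumTo (suc N) (λ j → (shiftʳ t j + μ j * t (suc j)) * a j) ∎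
    where
    open ≡-Reasoning
    μa : ℕ → ℕ
    μa i = μ i * a i

  -- Non-backtracking walks

  avoids : ∀ {n} → Maybe (Fin n) → Fin n → Bool
  avoids nothing  y = true
  avoids (just p) y = not (eqᵇ p y)

  module NonBacktracking {n : ℕ} (G : Graph n) where
    open Walks G

    nbWalks : ℕ → Maybe (Fin n) → Fin n → Fin n → ℕ
    nbWalks zero    p x v = ⟦ eqᵇ x v ⟧
    nbWalks (suc m) p x v = ∑[ y < n ] (⟦ adj G x y ∧ avoids p y ⟧ * nbWalks m (just x) y v)

    nb : ℕ → Fin n → Fin n → ℕ
    nb m = nbWalks m nothing

    A-nb₀ : ∀ u v → ∑[ w < n ] (A u w * nb 0 w v) ≡ nb 1 u v
    A-nb₀ u v = sum-cong-≗ λ w → cong (λ b → ⟦ b ⟧ * nb 0 w v) (sym (∧-identityʳ (adj G u w)))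

    nb-first-step : ∀ m u w v → nb (suc m) w v ≡ nbWalks (suc m) (just u) w v + A w u * nbWalks m (just w) u v
    nb-first-step m u w v = begin
      ∑[ y < n ] (⟦ adj G w y ∧ true ⟧ * X y)
        ≡⟨ sum-cong-≗ (λ y → split (adj G w y) (eqᵇ u y) (X y)) ⟩
      ∑[ y < n ] (⟦ adj G w y ∧ not (eqᵇ u y) ⟧ * X y + ⟦ eqᵇ u y ⟧ * (A w y * X y))
        ≡⟨ ∑-distrib-+ (λ y → ⟦ adj G w y ∧ not (eqᵇ u y) ⟧ * X y) (λ y → ⟦ eqᵇ u y ⟧ * (A w y * X y)) ⟩
      nbWalks (suc m) (just u) w v + ∑[ y < n ] (⟦ eqᵇ u y ⟧ * (A w y * X y))
        ≡⟨ cong (nbWalks (suc m) (just u) w v +_) (sum-δ u (λ y → A w y * X y)) ⟩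
      nbWalks (suc m) (just u) w v + A w u * X u ∎
      where
      open ≡-Reasoning
      X : Fin n → ℕ
      X y = nbWalks m (just w) y v
      split : ∀ a e x → ⟦ a ∧ true ⟧ * x ≡ ⟦ a ∧ not e ⟧ * x + ⟦ e ⟧ * (⟦ a ⟧ * x)
      split true  true  x = sym (+-identityʳ (x + 0))
      split true  false x = sym (+-identityʳ (x + 0))
      split false true  x = refl
      split false false x = refl

    A-nb-step : ∀ m u v →
      ∑[ w < n ] (A u w * nb (suc m) w v) ≡ nb (2 + m) u v + ∑[ w < n ] (A u w * nbWalks m (just w) u v)
    A-nb-step m u v = begin
      ∑[ w < n ] (A u w * nb (suc m) w v)
        ≡⟨ sum-cong-≗ (λ w → trans (cong (A u w *_) (nb-first-step m u w v)) (*-distribˡ-+ (A u w) _ _)) ⟩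
      ∑[ w < n ] (A u w * nbWalks (suc m) (just u) w v + A u w * (A w u * X w))
        ≡⟨ ∑-distrib-+ (λ w → A u w * nbWalks (suc m) (just u) w v) (λ w → A u w * (A w u * X w)) ⟩
      ∑[ w < n ] (A u w * nbWalks (suc m) (just u) w v) + ∑[ w < n ] (A u w * (A w u * X w))
        ≡⟨ cong₂ _+_ (sum-cong-≗ λ w → cong (λ b → ⟦ b ⟧ * nbWalks (suc m) (just u) w v) (sym (∧-identityʳ (adj G u w))))
                     (sum-cong-≗ λ w → there-and-back w) ⟩
      nb (2 + m) u v + ∑[ w < n ] (A u w * X w) ∎
      where
      open ≡-Reasoning
      X : Fin n → ℕ
      X w = nbWalks m (just w) u v
      there-and-back : ∀ w → A u w * (A w u * X w) ≡ A u w * X w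
      there-and-back w = begin
        A u w * (A w u * X w)   ≡⟨ cong (λ a → A u w * (a * X w)) (A-sym w u) ⟩
        A u w * (A u w * X w)   ≡⟨ *-assoc (A u w) (A u w) (X w) ⟨
        A u w * A u w * X w     ≡⟨ cong (_* X w) (⟦⟧-idem (adj G u w)) ⟩
        A u w * X w             ∎

    module _ {k : ℕ} (reg : Regular G k) where

      sum-A : ∀ u → sum (A u) ≡ k
      sum-A u = trans (sym (degree≡sum u)) (reg u)

      neighbours-except : ∀ u y → ∑[ w < n ] (A u w * ⟦ adj G u y ∧ not (eqᵇ w y) ⟧) ≡ A u y * (k ∸ 1)
      neighbours-except u y with adj G u y in uy
      ... | false = sum-zero λ w → *-zeroʳ (A u w)
      ... | true  = begin
        S
          ≡⟨ m+n∸n≡m S 1 ⟨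
        S + 1 ∸ 1
          ≡⟨ cong (λ a → S + a ∸ 1) (trans (cong ⟦_⟧ (sym uy)) (sym (sum-δ′ y (A u)))) ⟩
        S + ∑[ w < n ] (⟦ eqᵇ w y ⟧ * A u w) ∸ 1
          ≡⟨ cong (_∸ 1) (∑-distrib-+ (λ w → A u w * ⟦ not (eqᵇ w y) ⟧) _) ⟨
        ∑[ w < n ] (A u w * ⟦ not (eqᵇ w y) ⟧ + ⟦ eqᵇ w y ⟧ * A u w) ∸ 1
          ≡⟨ cong (_∸ 1) (trans (sum-cong-≗ λ w → partition (A u w) (eqᵇ w y)) (sum-A u)) ⟩
        k ∸ 1
          ≡⟨ +-identityʳ (k ∸ 1) ⟨
        (k ∸ 1) + 0 ∎
        where
        open ≡-Reasoning
        S : ℕ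
        S = ∑[ w < n ] (A u w * ⟦ not (eqᵇ w y) ⟧)
        partition : ∀ x e → x * ⟦ not e ⟧ + ⟦ e ⟧ * x ≡ x
        partition x true  = trans (cong (_+ (x + 0)) (*-zeroʳ x)) (+-identityʳ x)
        partition x false = trans (cong (_+ 0) (*-identityʳ x)) (+-identityʳ x)

      backtracks : ∀ m u v → ∑[ w < n ] (A u w * nbWalks m (just w) u v) ≡ branching k m * nb m u v
      backtracks zero    u v = trans (sym (*-distribʳ-sum (nb 0 u v) (A u))) (cong (_* nb 0 u v) (sum-A u))
      backtracks (suc m) u v = begin
        ∑[ w < n ] (A u w * ∑[ y < n ] (⟦ adj G u y ∧ not (eqᵇ w y) ⟧ * X y))
          ≡⟨ sum-cong-≗ (λ w → *-distribˡ-sum (A u w) (λ y → ⟦ adj G u y ∧ not (eqᵇ w y) ⟧ * X y)) ⟩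
        ∑[ w < n ] ∑[ y < n ] (A u w * (⟦ adj G u y ∧ not (eqᵇ w y) ⟧ * X y))
          ≡⟨ ∑-comm (λ w y → A u w * (⟦ adj G u y ∧ not (eqᵇ w y) ⟧ * X y)) ⟩
        ∑[ y < n ] ∑[ w < n ] (A u w * (⟦ adj G u y ∧ not (eqᵇ w y) ⟧ * X y))
          ≡⟨ sum-cong-≗ (λ y → trans (sum-cong-≗ λ w → sym (*-assoc (A u w) _ (X y)))
                                     (sym (*-distribʳ-sum (X y) (λ w → A u w * ⟦ adj G u y ∧ not (eqᵇ w y) ⟧)))) ⟩
        ∑[ y < n ] (∑[ w < n ] (A u w * ⟦ adj G u y ∧ not (eqᵇ w y) ⟧) * X y)
          ≡⟨ sum-cong-≗ (λ y → trans (cong (_* X y) (neighbours-except u y)) (reorder (A u y) (k ∸ 1) (X y))) ⟩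
        ∑[ y < n ] ((k ∸ 1) * (A u y * X y))
          ≡⟨ *-distribˡ-sum (k ∸ 1) (λ y → A u y * X y) ⟨
        (k ∸ 1) * ∑[ y < n ] (A u y * X y)
          ≡⟨ cong ((k ∸ 1) *_) (sum-cong-≗ λ y → cong (λ b → ⟦ b ⟧ * X y) (sym (∧-identityʳ (adj G u y)))) ⟩
        (k ∸ 1) * nb (suc m) u v ∎
        where
        open ≡-Reasoning
        X : Fin n → ℕ
        X y = nbWalks m (just u) y v
        reorder : ∀ a b c → a * b * c ≡ b * (a * c)
        reorder = solve-∀

      -- A A₀ = A₁, A A₁ = A₂ + k A₀ and A Aⱼ = Aⱼ₊₁ + (k − 1) Aⱼ₋₁ for j ≥ 2:
      -- a further step either extends the non-backtracking walk or retraces its last edge.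
      A-nb : ∀ j u v → ∑[ w < n ] (A u w * nb j w v) ≡ nb (suc j) u v + shiftʳ (λ i → branching k i * nb i u v) j
      A-nb zero    u v = trans (A-nb₀ u v) (sym (+-identityʳ _))
      A-nb (suc m) u v = trans (A-nb-step m u v) (cong (nb (2 + m) u v +_) (backtracks m u v))

      -- Multiplying by A and applying A-nb reproduces the recurrence that defines treeWalks.
      walks≡nb : ∀ ℓ u v → walks ℓ u v ≡ sumTo (suc ℓ) (λ j → treeWalks k ℓ j * nb j u v)
      walks≡nb zero    u v = sym (trans (+-identityʳ (nb 0 u v + 0)) (+-identityʳ (nb 0 u v)))
      walks≡nb (suc ℓ) u v = begin
        ∑[ w < n ] (A u w * walks ℓ w v)
          ≡⟨ sum-cong-≗ (λ w → cong (A u w *_) (walks≡nb ℓ w v)) ⟩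
        ∑[ w < n ] (A u w * sumTo (suc ℓ) (λ j → t j * nb j w v))
          ≡⟨ sum-cong-≗ {n} (λ w → *-distribˡ-sum {suc ℓ} (A u w) (λ j → t (toℕ j) * nb (toℕ j) w v)) ⟩
        ∑[ w < n ] sumTo (suc ℓ) (λ j → A u w * (t j * nb j w v))
          ≡⟨ ∑-comm {n} {suc ℓ} (λ w j → A u w * (t (toℕ j) * nb (toℕ j) w v)) ⟩
        sumTo (suc ℓ) (λ j → ∑[ w < n ] (A u w * (t j * nb j w v)))
          ≡⟨ sum-cong-≗ {suc ℓ} (λ j → trans (sum-cong-≗ λ w → reorder (A u w) (t (toℕ j)) _)
                                     (sym (*-distribˡ-sum (t (toℕ j)) (λ w → A u w * nb (toℕ j) w v)))) ⟩
        sumTo (suc ℓ) (λ j → t j * ∑[ w < n ] (A u w * nb j w v))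
          ≡⟨ sum-cong-≗ {suc ℓ} (λ j → cong (t (toℕ j) *_) (A-nb (toℕ j) u v)) ⟩
        sumTo (suc ℓ) (λ j → t j * (nb (suc j) u v + shiftʳ (λ i → branching k i * nb i u v) j))
          ≡⟨ transfer (branching k) t (λ j → nb j u v) (suc ℓ) (λ j → treeWalks-beyond k ℓ j) ⟩
        sumTo (2 + ℓ) (λ j → (shiftʳ t j + branching k j * t (suc j)) * nb j u v)
          ≡⟨ sum-cong-≗ {2 + ℓ} (λ j → cong (_* nb (toℕ j) u v) (sym (treeWalks-suc k ℓ (toℕ j)))) ⟩
        sumTo (2 + ℓ) (λ j → treeWalks k (suc ℓ) j * nb j u v) ∎
        where
        open ≡-Reasoning
        t : ℕ → ℕ
        t = treeWalks k ℓ
        reorder : ∀ a b c → a * (b * c) ≡ b * (a * c)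
        reorder = solve-∀

  module _ {A : Set} (p : A → Bool) where

    any-++ : ∀ xs ys → anyᵇ p (xs ++ ys) ≡ anyᵇ p xs ∨ anyᵇ p ys
    any-++ []       ys = refl
    any-++ (x ∷ xs) ys = trans (cong (p x ∨_) (any-++ xs ys)) (sym (∨-assoc (p x) _ _))

    any-reverse : ∀ xs → anyᵇ p (reverse xs) ≡ anyᵇ p xs
    any-reverse []       = refl
    any-reverse (x ∷ xs) = begin
      anyᵇ p (reverse (x ∷ xs))              ≡⟨ cong (anyᵇ p) (unfold-reverse x xs) ⟩
      anyᵇ p (reverse xs ++ x ∷ [])          ≡⟨ any-++ (reverse xs) (x ∷ []) ⟩
      anyᵇ p (reverse xs) ∨ (p x ∨ false)    ≡⟨ cong₂ _∨_ (any-reverse xs) (∨-identityʳ (p x)) ⟩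
      anyᵇ p xs ∨ p x                        ≡⟨ ∨-comm (anyᵇ p xs) (p x) ⟩
      p x ∨ anyᵇ p xs                        ∎
      where open ≡-Reasoning

  module _ {n : ℕ} where

    not-true : ∀ {a} → not a ≡ true → a ≡ false
    not-true {false} _ = refl

    distinct-head : ∀ (x : Fin n) xs → allDistinct (x ∷ xs) ≡ true → anyᵇ (eqᵇ x) xs ≡ false
    distinct-head x xs d = not-true (∧-conicalˡ _ _ d)

    distinct-tail : ∀ (x : Fin n) xs → allDistinct (x ∷ xs) ≡ true → allDistinct xs ≡ true
    distinct-tail x xs = ∧-conicalʳ _ _

    distinct-++ˡ : ∀ (xs ys : List (Fin n)) → allDistinct (xs ++ ys) ≡ true → allDistinct xs ≡ true
    distinct-++ˡ []       ys d = refl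
    distinct-++ˡ (x ∷ xs) ys d = cong₂ _∧_
      (cong not (∨-conicalˡ _ _ (trans (sym (any-++ (eqᵇ x) xs ys)) (distinct-head x (xs ++ ys) d))))
      (distinct-++ˡ xs ys (distinct-tail x (xs ++ ys) d))

    distinct-snoc : ∀ (xs : List (Fin n)) y → allDistinct (xs ++ y ∷ []) ≡ not (anyᵇ (eqᵇ y) xs) ∧ allDistinct xs
    distinct-snoc []       y = refl
    distinct-snoc (x ∷ xs) y = begin
      not (anyᵇ (eqᵇ x) (xs ++ y ∷ [])) ∧ allDistinct (xs ++ y ∷ [])
        ≡⟨ cong₂ (λ a d → not a ∧ d) (any-++ (eqᵇ x) xs (y ∷ [])) (distinct-snoc xs y) ⟩
      not (anyᵇ (eqᵇ x) xs ∨ (eqᵇ x y ∨ false)) ∧ (not (anyᵇ (eqᵇ y) xs) ∧ allDistinct xs)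
        ≡⟨ cong (λ e → not (anyᵇ (eqᵇ x) xs ∨ (e ∨ false)) ∧ (not (anyᵇ (eqᵇ y) xs) ∧ allDistinct xs)) (eqᵇ-sym x y) ⟩
      not (anyᵇ (eqᵇ x) xs ∨ (eqᵇ y x ∨ false)) ∧ (not (anyᵇ (eqᵇ y) xs) ∧ allDistinct xs)
        ≡⟨ shuffle (anyᵇ (eqᵇ x) xs) (eqᵇ y x) (anyᵇ (eqᵇ y) xs) (allDistinct xs) ⟩
      not (eqᵇ y x ∨ anyᵇ (eqᵇ y) xs) ∧ (not (anyᵇ (eqᵇ x) xs) ∧ allDistinct xs) ∎
      where
      open ≡-Reasoning
      shuffle : ∀ a e b d → not (a ∨ (e ∨ false)) ∧ (not b ∧ d) ≡ not (e ∨ b) ∧ (not a ∧ d)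
      shuffle true  true  b     d = refl
      shuffle true  false true  d = refl
      shuffle true  false false d = refl
      shuffle false true  b     d = refl
      shuffle false false b     d = refl

    distinct-reverse : ∀ (xs : List (Fin n)) → allDistinct (reverse xs) ≡ allDistinct xs
    distinct-reverse []       = refl
    distinct-reverse (x ∷ xs) = begin
      allDistinct (reverse (x ∷ xs))
        ≡⟨ cong allDistinct (unfold-reverse x xs) ⟩
      allDistinct (reverse xs ++ x ∷ [])
        ≡⟨ distinct-snoc (reverse xs) x ⟩
      not (anyᵇ (eqᵇ x) (reverse xs)) ∧ allDistinct (reverse xs)
        ≡⟨ cong₂ (λ a d → not a ∧ d) (any-reverse (eqᵇ x) xs) (distinct-reverse xs) ⟩
      not (anyᵇ (eqᵇ x) xs) ∧ allDistinct xs ∎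
      where open ≡-Reasoning

    split-at-first : ∀ (x : Fin n) xs → anyᵇ (eqᵇ x) xs ≡ true →
      Σ[ pre ∈ List (Fin n) ] Σ[ post ∈ List (Fin n) ] (xs ≡ pre ++ x ∷ post) × (anyᵇ (eqᵇ x) pre ≡ false)
    split-at-first x (z ∷ zs) x∈ with eqᵇ x z in x≟z
    ... | true  = [] , zs , cong (_∷ zs) (sym (eqᵇ-sound x≟z)) , refl
    ... | false with split-at-first x zs x∈
    ...   | pre , post , zs≡ , x∉pre = z ∷ pre , post , cong (z ∷_) zs≡ , trans (cong (_∨ anyᵇ (eqᵇ x) pre) x≟z) x∉pre

  module Cycles {n : ℕ} (G : Graph n) where
    open Sequences n

    cycle-distinct : ∀ u ys → isCycleSeq G (u ∷ ys) ≡ true → allDistinct (u ∷ ys) ≡ true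
    cycle-distinct u ys = ∧-conicalˡ _ _

    cycle-closed : ∀ u ys → isCycleSeq G (u ∷ ys) ≡ true → pathBackTo G u (u ∷ ys) ≡ true
    cycle-closed u ys = ∧-conicalʳ _ _

    linked : List (Fin n) → Bool
    linked []           = true
    linked (a ∷ [])     = true
    linked (a ∷ b ∷ xs) = adj G a b ∧ linked (b ∷ xs)

    pathBackTo≡linked : ∀ b a xs → pathBackTo G b (a ∷ xs) ≡ linked (a ∷ xs ++ b ∷ [])
    pathBackTo≡linked b a []       = sym (∧-identityʳ (adj G a b))
    pathBackTo≡linked b a (z ∷ zs) = cong (adj G a z ∧_) (pathBackTo≡linked b z zs)

    linked-snoc : ∀ xs a b → linked (xs ++ a ∷ b ∷ []) ≡ linked (xs ++ a ∷ []) ∧ adj G a b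
    linked-snoc []           a b = ∧-comm (adj G a b) true
    linked-snoc (x ∷ [])     a b = trans (cong (adj G x a ∧_) (∧-identityʳ (adj G a b)))
                                         (cong (_∧ adj G a b) (sym (∧-identityʳ (adj G x a))))
    linked-snoc (x ∷ y ∷ xs) a b = trans (cong (adj G x y ∧_) (linked-snoc (y ∷ xs) a b)) (sym (∧-assoc (adj G x y) _ _))

    linked-reverse : ∀ xs → linked (reverse xs) ≡ linked xs
    linked-reverse []           = refl
    linked-reverse (a ∷ [])     = refl
    linked-reverse (a ∷ b ∷ xs) = begin
      linked (reverse (a ∷ b ∷ xs))                  ≡⟨ cong linked (unfold-reverse² a b xs) ⟩
      linked (reverse xs ++ b ∷ a ∷ [])              ≡⟨ linked-snoc (reverse xs) b a ⟩
      linked (reverse xs ++ b ∷ []) ∧ adj G b a      ≡⟨ cong (λ ys → linked ys ∧ adj G b a) (unfold-reverse b xs) ⟨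
      linked (reverse (b ∷ xs)) ∧ adj G b a          ≡⟨ cong₂ _∧_ (linked-reverse (b ∷ xs)) (adj-sym G b a) ⟩
      linked (b ∷ xs) ∧ adj G a b                    ≡⟨ ∧-comm (linked (b ∷ xs)) (adj G a b) ⟩
      linked (a ∷ b ∷ xs)                            ∎
      where
      open ≡-Reasoning
      unfold-reverse² : ∀ a b xs → reverse (a ∷ b ∷ xs) ≡ reverse xs ++ b ∷ a ∷ []
      unfold-reverse² a b xs = trans (unfold-reverse a (b ∷ xs))
        (trans (cong (_++ a ∷ []) (unfold-reverse b xs)) (++-assoc (reverse xs) (b ∷ []) (a ∷ [])))

    isCycleSeq-reverse : ∀ u ys → isCycleSeq G (u ∷ reverse ys) ≡ isCycleSeq G (u ∷ ys)
    isCycleSeq-reverse u ys = cong₂ _∧_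
      (cong₂ (λ a d → not a ∧ d) (any-reverse (eqᵇ u) ys) (distinct-reverse ys))
      (begin
        pathBackTo G u (u ∷ reverse ys)        ≡⟨ pathBackTo≡linked u u (reverse ys) ⟩
        linked (u ∷ reverse ys ++ u ∷ [])      ≡⟨ cong linked reverse-closed ⟨
        linked (reverse (u ∷ ys ++ u ∷ []))    ≡⟨ linked-reverse (u ∷ ys ++ u ∷ []) ⟩
        linked (u ∷ ys ++ u ∷ [])              ≡⟨ pathBackTo≡linked u u ys ⟨
        pathBackTo G u (u ∷ ys)                ∎)
      where
      open ≡-Reasoning
      reverse-closed : reverse (u ∷ ys ++ u ∷ []) ≡ u ∷ reverse ys ++ u ∷ []
      reverse-closed = trans (unfold-reverse u (ys ++ u ∷ [])) (cong (_++ u ∷ []) (reverse-++ ys (u ∷ [])))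

    -- The second vertex of a cycle sequence differs from its last one.
    cycle-not-palindrome : ∀ u ys → 2 ≤ length ys → isCycleSeq G (u ∷ ys) ≡ true → reverse ys ≢ ys
    cycle-not-palindrome u (y ∷ [])         (s≤s ())
    cycle-not-palindrome u (y ∷ zs@(_ ∷ _)) _ cyc palindrome with reverse zs in rev-zs
    ... | []    = zs≢[] (trans (sym (reverse-involutive zs)) (cong reverse rev-zs))
      where
      zs≢[] : zs ≢ []
      zs≢[] ()
    ... | w ∷ r = true≢false (trans (sym y∈zs) (distinct-head y zs (distinct-tail u (y ∷ zs) (cycle-distinct u (y ∷ zs) cyc))))
      where
      w≡y : w ≡ y
      w≡y = cong (λ { [] → w ; (x ∷ _) → x })
                 (trans (cong (_++ y ∷ []) (sym rev-zs)) (trans (sym (unfold-reverse y zs)) palindrome))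
      y∈zs : anyᵇ (eqᵇ y) zs ≡ true
      y∈zs = trans (sym (any-reverse (eqᵇ y) zs))
               (trans (cong (anyᵇ (eqᵇ y)) rev-zs) (cong (_∨ anyᵇ (eqᵇ y) r) (trans (cong (eqᵇ y) w≡y) (eqᵇ-refl y))))

    rootedCycleSeqs≡2*cyclesThrough : ∀ u ℓ → 3 ≤ ℓ → rootedCycleSeqs G u ℓ ≡ 2 * cyclesThrough G u ℓ
    rootedCycleSeqs≡2*cyclesThrough u (suc m) (s≤s 2≤m) =
      trans even (cong (2 *_) (sym (trans (cong (_/ 2) even) (2h/2≡h half))))
      where
      half : ℕ
      half = #[ (λ ys → isCycleSeq G (u ∷ ys) ∧ precedes ys (reverse ys)) ] m
      even : rootedCycleSeqs G u (suc m) ≡ 2 * half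
      even = #-even m (λ ys → isCycleSeq G (u ∷ ys)) (isCycleSeq-reverse u)
               (λ ys len → cycle-not-palindrome u ys (subst (2 ≤_) (sym len) 2≤m))
      2h/2≡h : ∀ h → 2 * h / 2 ≡ h
      2h/2≡h h = trans (cong (_/ 2) (*-comm 2 h)) (m*n/n≡m h 2)

  module NonBacktrackingSequences {n : ℕ} (G : Graph n) where
    open NonBacktracking G
    open Sequences n
    open Cycles G

    isNBWalk : Maybe (Fin n) → Fin n → List (Fin n) → Bool
    isNBWalk p x []       = true
    isNBWalk p x (y ∷ ys) = (adj G x y ∧ avoids p y) ∧ isNBWalk (just x) y ys

    nbWalks≡# : ∀ m p x v → nbWalks (suc m) p x v ≡ #[ (λ ys → isNBWalk p x (ys ++ v ∷ [])) ] m
    nbWalks≡# zero    p x v = begin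
      ∑[ y < n ] (⟦ adj G x y ∧ avoids p y ⟧ * ⟦ eqᵇ y v ⟧)
        ≡⟨ sum-cong-≗ (λ y → *-comm ⟦ adj G x y ∧ avoids p y ⟧ ⟦ eqᵇ y v ⟧) ⟩
      ∑[ y < n ] (⟦ eqᵇ y v ⟧ * ⟦ adj G x y ∧ avoids p y ⟧)
        ≡⟨ sum-δ′ v (λ y → ⟦ adj G x y ∧ avoids p y ⟧) ⟩
      ⟦ adj G x v ∧ avoids p v ⟧
        ≡⟨ cong ⟦_⟧ (∧-identityʳ (adj G x v ∧ avoids p v)) ⟨
      ⟦ (adj G x v ∧ avoids p v) ∧ true ⟧
        ≡⟨ +-identityʳ _ ⟨
      #[ (λ ys → isNBWalk p x (ys ++ v ∷ [])) ] 0 ∎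
      where open ≡-Reasoning
    nbWalks≡# (suc m) p x v = begin
      ∑[ y < n ] (⟦ step y ⟧ * nbWalks (suc m) (just x) y v)
        ≡⟨ sum-cong-≗ (λ y → cong (⟦ step y ⟧ *_) (nbWalks≡# m (just x) y v)) ⟩
      ∑[ y < n ] (⟦ step y ⟧ * #[ (λ ys → isNBWalk (just x) y (ys ++ v ∷ [])) ] m)
        ≡⟨ sum-cong-≗ (λ y → count-const-∧ (step y) (λ ys → isNBWalk (just x) y (ys ++ v ∷ [])) (allLists n m)) ⟨
      ∑[ y < n ] #[ (λ ys → isNBWalk p x (y ∷ ys ++ v ∷ [])) ] m
        ≡⟨ #-cons m (λ ys → isNBWalk p x (ys ++ v ∷ [])) ⟨
      #[ (λ ys → isNBWalk p x (ys ++ v ∷ [])) ] suc m ∎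
      where
      open ≡-Reasoning
      step : Fin n → Bool
      step y = adj G x y ∧ avoids p y

    module _ p x y ys (walk : isNBWalk p x (y ∷ ys) ≡ true) where
      nbWalk-adj : adj G x y ≡ true
      nbWalk-adj = ∧-conicalˡ (adj G x y) _ (∧-conicalˡ (adj G x y ∧ avoids p y) _ walk)

      nbWalk-avoids : avoids p y ≡ true
      nbWalk-avoids = ∧-conicalʳ (adj G x y) _ (∧-conicalˡ (adj G x y ∧ avoids p y) _ walk)

      nbWalk-tail : isNBWalk (just x) y ys ≡ true
      nbWalk-tail = ∧-conicalʳ (adj G x y ∧ avoids p y) _ walk

    nbWalk-++ˡ : ∀ p a xs ys → isNBWalk p a (xs ++ ys) ≡ true → isNBWalk p a xs ≡ true
    nbWalk-++ˡ p a []       ys walk = refl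
    nbWalk-++ˡ p a (x ∷ xs) ys walk = cong₂ _∧_
      (cong₂ _∧_ (nbWalk-adj p a x (xs ++ ys) walk) (nbWalk-avoids p a x (xs ++ ys) walk))
      (nbWalk-++ˡ (just a) x xs ys (nbWalk-tail p a x (xs ++ ys) walk))

    nbWalk⇒pathBackTo : ∀ p a pre b post → isNBWalk p a (pre ++ b ∷ post) ≡ true → pathBackTo G b (a ∷ pre) ≡ true
    nbWalk⇒pathBackTo p a []        b post walk = nbWalk-adj p a b post walk
    nbWalk⇒pathBackTo p a (z ∷ pre) b post walk =
      cong₂ _∧_ (nbWalk-adj p a z (pre ++ b ∷ post) walk)
                (nbWalk⇒pathBackTo (just a) z pre b post (nbWalk-tail p a z (pre ++ b ∷ post) walk))

    path⇒nbWalk : ∀ p a xs b → allDistinct (a ∷ xs) ≡ true → anyᵇ (eqᵇ b) (a ∷ xs) ≡ false →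
      pathBackTo G b (a ∷ xs) ≡ true → avoids p (fromMaybe b (head xs)) ≡ true → isNBWalk p a (xs ++ b ∷ []) ≡ true
    path⇒nbWalk p a []       b _ _   path first = cong₂ _∧_ (cong₂ _∧_ path first) refl
    path⇒nbWalk p a (z ∷ zs) b d b∉ path first = cong₂ _∧_ (cong₂ _∧_ (∧-conicalˡ (adj G a z) _ path) first)
      (path⇒nbWalk (just a) z zs b (distinct-tail a (z ∷ zs) d) (∨-conicalʳ (eqᵇ b a) _ b∉) (∧-conicalʳ (adj G a z) _ path)
                   (next zs (distinct-head a (z ∷ zs) d)))
      where
      next : ∀ zs → anyᵇ (eqᵇ a) (z ∷ zs) ≡ false → avoids (just a) (fromMaybe b (head zs)) ≡ true
      next []      _  = cong not (trans (eqᵇ-sym a b) (∨-conicalˡ (eqᵇ b a) _ b∉))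
      next (w ∷ _) a∉ = cong not (∨-conicalˡ (eqᵇ a w) _ (∨-conicalʳ (eqᵇ a z) _ a∉))

    module BelowGirth (g : ℕ)
      (acyclic : ∀ w ys → 2 ≤ length ys → suc (length ys) < g → isCycleSeq G (w ∷ ys) ≡ false) where

      -- A first return to x closes a loop (pre = []), a backtrack (pre = [z]) or a short cycle.
      no-early-return : ∀ p x pre post → isNBWalk p x (pre ++ x ∷ post) ≡ true → allDistinct (pre ++ x ∷ post) ≡ true →
        anyᵇ (eqᵇ x) pre ≡ false → length (pre ++ x ∷ post) < g → ⊥
      no-early-return p x []       post walk _ _ _ = true≢false (trans (sym (nbWalk-adj p x x post walk)) (irrefl G x))
      no-early-return p x (z ∷ []) post walk _ _ _ =
        true≢false (trans (sym (nbWalk-avoids (just x) z x post (nbWalk-tail p x z (x ∷ post) walk))) (cong not (eqᵇ-refl x)))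
      no-early-return p x pre@(_ ∷ _ ∷ _) post walk distinct x∉pre short =
        true≢false (trans (sym cycle) (acyclic x pre (s≤s (s≤s z≤n)) (<-≤-trans (s≤s pre<) short)))
        where
        cycle : isCycleSeq G (x ∷ pre) ≡ true
        cycle = cong₂ _∧_ (cong₂ _∧_ (cong not x∉pre) (distinct-++ˡ pre (x ∷ post) distinct))
                          (nbWalk⇒pathBackTo p x pre x post walk)
        pre< : length pre < length (pre ++ x ∷ post)
        pre< = subst (length pre <_) (sym (trans (length-++ pre) (+-suc (length pre) (length post)))) (s≤s (m≤m+n _ _))

      nbWalk-distinct : ∀ p x t → isNBWalk p x t ≡ true → length t < g → allDistinct (x ∷ t) ≡ true
      nbWalk-distinct p x []       walk short = refl
      nbWalk-distinct p x (y ∷ t) walk short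
        with nbWalk-distinct (just x) y t (nbWalk-tail p x y t walk) (<-trans (n<1+n _) short) | anyᵇ (eqᵇ x) (y ∷ t) in x∈
      ... | distinct | false = distinct
      ... | distinct | true  with split-at-first x (y ∷ t) x∈
      ...   | pre , post , t≡ , x∉pre = ⊥-elim (no-early-return p x pre post
              (subst (λ l → isNBWalk p x l ≡ true) t≡ walk) (subst (λ l → allDistinct l ≡ true) t≡ distinct) x∉pre
              (subst (λ l → length l < g) t≡ short))

      closed-nbWalk-short : ∀ u ys → suc (length ys) < g → isNBWalk nothing u (ys ++ u ∷ []) ≡ false
      closed-nbWalk-short u ys short with isNBWalk nothing u (ys ++ u ∷ []) in walk
      ... | false = refl
      ... | true  = ⊥-elim (true≢false (trans (sym (nbWalk-distinct nothing u (ys ++ u ∷ []) walk len<g)) u-repeats))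
        where
        len<g : length (ys ++ u ∷ []) < g
        len<g = subst (_< g) (sym (trans (length-++ ys) (+-comm (length ys) 1))) short
        u-repeats : allDistinct (u ∷ ys ++ u ∷ []) ≡ false
        u-repeats = cong (λ a → not a ∧ allDistinct (ys ++ u ∷ []))
          (trans (any-++ (eqᵇ u) ys (u ∷ [])) (trans (cong (λ b → anyᵇ (eqᵇ u) ys ∨ (b ∨ false)) (eqᵇ-refl u)) (∨-zeroʳ _)))

      closed-nbWalk-girth : ∀ u ys → 2 ≤ length ys → suc (length ys) ≡ g →
        isNBWalk nothing u (ys ++ u ∷ []) ≡ isCycleSeq G (u ∷ ys)
      closed-nbWalk-girth u ys 2≤len len≡g = ⇔→≡ {z = true} (mk⇔ to (from ys 2≤len))
        where
        to : isNBWalk nothing u (ys ++ u ∷ []) ≡ true → isCycleSeq G (u ∷ ys) ≡ true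
        to walk = cong₂ _∧_
          (nbWalk-distinct nothing u ys (nbWalk-++ˡ nothing u ys (u ∷ []) walk) (subst (length ys <_) len≡g (n<1+n _)))
          (nbWalk⇒pathBackTo nothing u ys u [] walk)
        from : ∀ ys → 2 ≤ length ys → isCycleSeq G (u ∷ ys) ≡ true → isNBWalk nothing u (ys ++ u ∷ []) ≡ true
        from (y ∷ [])     (s≤s ())
        from (y ∷ z ∷ zs) _ cyc = cong₂ _∧_ (cong₂ _∧_ (∧-conicalˡ (adj G u y) _ path) refl)
          (path⇒nbWalk (just u) y (z ∷ zs) u (distinct-tail u (y ∷ z ∷ zs) d) (distinct-head u (y ∷ z ∷ zs) d)
                       (∧-conicalʳ (adj G u y) _ path)
                       (cong not (∨-conicalˡ (eqᵇ u z) _ (∨-conicalʳ (eqᵇ u y) _ (distinct-head u (y ∷ z ∷ zs) d)))))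
          where
          d : allDistinct (u ∷ y ∷ z ∷ zs) ≡ true
          d = cycle-distinct u (y ∷ z ∷ zs) cyc
          path : pathBackTo G u (u ∷ y ∷ z ∷ zs) ≡ true
          path = cycle-closed u (y ∷ z ∷ zs) cyc

  module VGR {n : ℕ} (G : Graph n) {k g λ′ : ℕ} (vgr : IsVGR G k g λ′) where
    open Walks G
    open NonBacktracking G
    open NonBacktrackingSequences G
    open Cycles G
    open Sequences n

    regular : Regular G k
    regular = proj₁ vgr

    3≤g : 3 ≤ g
    3≤g = proj₁ (proj₁ (proj₂ vgr))

    no-short-cycles : ∀ ℓ → 3 ≤ ℓ → ℓ < g → ∀ v → cyclesThrough G v ℓ ≡ 0
    no-short-cycles = proj₁ (proj₂ (proj₁ (proj₂ vgr)))

    vertex : Fin n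
    vertex = proj₁ (proj₂ (proj₂ (proj₁ (proj₂ vgr))))

    vertex-on-cycle : cyclesThrough G vertex g ≢ 0
    vertex-on-cycle = proj₂ (proj₂ (proj₂ (proj₁ (proj₂ vgr))))

    λ′-cycles : ∀ v → cyclesThrough G v g ≡ λ′
    λ′-cycles = proj₂ (proj₂ vgr)

    acyclic : ∀ w ys → 2 ≤ length ys → suc (length ys) < g → isCycleSeq G (w ∷ ys) ≡ false
    acyclic w ys 2≤len short with isCycleSeq G (w ∷ ys) in cyc
    ... | false = refl
    ... | true  = ⊥-elim (<⇒≱ z<s (subst (1 ≤_) no-cycles (#-pos (λ xs → isCycleSeq G (w ∷ xs)) ys cyc)))
      where
      no-cycles : rootedCycleSeqs G w (suc (length ys)) ≡ 0
      no-cycles = trans (rootedCycleSeqs≡2*cyclesThrough w (suc (length ys)) (s≤s 2≤len))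
                        (cong (2 *_) (no-short-cycles (suc (length ys)) (s≤s 2≤len) short w))

    open BelowGirth g acyclic

    nb-closed-short : ∀ j → suc j < g → ∀ u → nb (suc j) u u ≡ 0
    nb-closed-short j short u = trans (nbWalks≡# j nothing u u)
      (#-zero j _ λ ys len → closed-nbWalk-short u ys (subst (λ m → suc m < g) (sym len) short))

    nb-closed-girth : ∀ m → suc m ≡ g → ∀ u → nb (suc m) u u ≡ 2 * λ′
    nb-closed-girth m 1+m≡g u = begin
      nb (suc m) u u
        ≡⟨ nbWalks≡# m nothing u u ⟩
      #[ (λ ys → isNBWalk nothing u (ys ++ u ∷ [])) ] m
        ≡⟨ #-cong m (λ ys len → closed-nbWalk-girth u ys (subst (2 ≤_) (sym len) 2≤m) (trans (cong suc len) 1+m≡g)) ⟩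
      rootedCycleSeqs G u (suc m)
        ≡⟨ rootedCycleSeqs≡2*cyclesThrough u (suc m) (s≤s 2≤m) ⟩
      2 * cyclesThrough G u (suc m)
        ≡⟨ cong (λ ℓ → 2 * cyclesThrough G u ℓ) 1+m≡g ⟩
      2 * cyclesThrough G u g
        ≡⟨ cong (2 *_) (λ′-cycles u) ⟩
      2 * λ′ ∎
      where
      open ≡-Reasoning
      2≤m : 2 ≤ m
      2≤m = ≤-pred (subst (3 ≤_) (sym 1+m≡g) 3≤g)

    closedWalks-short : ∀ ℓ → ℓ < g → ∀ u → walks ℓ u u ≡ c ℓ k
    closedWalks-short ℓ ℓ<g u = begin
      walks ℓ u u
        ≡⟨ walks≡nb regular ℓ u u ⟩
      treeWalks k ℓ 0 * nb 0 u u + sumTo ℓ (λ j → treeWalks k ℓ (suc j) * nb (suc j) u u)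
        ≡⟨ cong₂ _+_ (cong (c ℓ k *_) (cong ⟦_⟧ (eqᵇ-refl u))) (sumTo-zero ℓ _ no-return) ⟩
      c ℓ k * 1 + 0
        ≡⟨ trans (+-identityʳ _) (*-identityʳ _) ⟩
      c ℓ k ∎
      where
      open ≡-Reasoning
      no-return : ∀ j → j < ℓ → treeWalks k ℓ (suc j) * nb (suc j) u u ≡ 0
      no-return j j<ℓ = trans (cong (treeWalks k ℓ (suc j) *_) (nb-closed-short j (<-≤-trans (s≤s j<ℓ) ℓ<g) u))
                              (*-zeroʳ (treeWalks k ℓ (suc j)))

    closedWalks-girth : ∀ u → walks g u u ≡ c g k + 2 * λ′
    closedWalks-girth u = at-girth g refl
      where
      open ≡-Reasoning
      at-girth : ∀ ℓ → ℓ ≡ g → walks ℓ u u ≡ c ℓ k + 2 * λ′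
      at-girth zero    0≡g with subst (3 ≤_) (sym 0≡g) 3≤g
      ... | ()
      at-girth (suc m) 1+m≡g = begin
        walks (suc m) u u
          ≡⟨ walks≡nb regular (suc m) u u ⟩
        treeWalks k (suc m) 0 * nb 0 u u + sumTo (suc m) F
          ≡⟨ cong₂ _+_ (cong (c (suc m) k *_) (cong ⟦_⟧ (eqᵇ-refl u))) (sumTo-snoc m F) ⟩
        c (suc m) k * 1 + (sumTo m F + F m)
          ≡⟨ cong₂ _+_ (*-identityʳ (c (suc m) k)) (cong₂ _+_ (sumTo-zero m F no-return) cycles) ⟩
        c (suc m) k + 2 * λ′ ∎
        where
        F : ℕ → ℕ
        F j = treeWalks k (suc m) (suc j) * nb (suc j) u u
        no-return : ∀ j → j < m → F j ≡ 0
        no-return j j<m = trans (cong (treeWalks k (suc m) (suc j) *_) (nb-closed-short j (subst (suc j <_) 1+m≡g (s≤s j<m)) u))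
                                (*-zeroʳ (treeWalks k (suc m) (suc j)))
        cycles : F m ≡ 2 * λ′
        cycles = trans (cong₂ _*_ (treeWalks-diagonal k (suc m)) (nb-closed-girth m 1+m≡g u)) (*-identityˡ (2 * λ′))

    sum-walks²-half : ∀ h → g ≡ h + h → ∀ u → ∑[ v < n ] (walks h u v * walks h u v) ≡ c g k + 2 * λ′
    sum-walks²-half h g≡h+h u = trans (sum-walks² h u) (trans (cong (λ ℓ → walks ℓ u u) (sym g≡h+h)) (closedWalks-girth u))

    half<g : ∀ h → g ≡ h + h → h < g
    half<g zero    g≡0 = ⊥-elim (<⇒≱ (s≤s z≤n) (subst (3 ≤_) g≡0 3≤g))
    half<g (suc h) g≡h+h = subst (suc h <_) (sym g≡h+h) (s≤s (m≤n+m (suc h) h))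

    -- A g-cycle through vertex yields closed walks of length g, which need edges.
    k≢0 : k ≢ 0
    k≢0 k≡0 = vertex-on-cycle (trans (λ′-cycles vertex) (n≤0⇒n≡0 (begin
      λ′                              ≤⟨ m≤m+n λ′ (λ′ + 0) ⟩
      2 * λ′                          ≤⟨ m≤n+m (2 * λ′) (c g k) ⟩
      c g k + 2 * λ′                  ≡⟨ closedWalks-girth vertex ⟨
      walks g vertex vertex           ≤⟨ term≤sum (walks g vertex) vertex ⟩
      sum (walks g vertex)            ≡⟨ sum-walks regular g vertex ⟩
      k ^ g                           ≡⟨ cong (_^ g) k≡0 ⟩
      0 ^ g                           ≡⟨ 0^-pos g (≤-trans (s≤s z≤n) 3≤g) ⟩
      0                               ∎)))
      where
      open ≤-Reasoning
      0^-pos : ∀ ℓ → 1 ≤ ℓ → 0 ^ ℓ ≡ 0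
      0^-pos (suc ℓ) _ = refl

  -- Bipartite graphs

  alternate : ℕ → Bool → Bool
  alternate zero    b = b
  alternate (suc ℓ) b = not (alternate ℓ b)

  alternate-not : ∀ ℓ b → alternate ℓ (not b) ≡ not (alternate ℓ b)
  alternate-not zero    b = refl
  alternate-not (suc ℓ) b = cong not (alternate-not ℓ b)

  alternate-+ : ∀ ℓ m b → alternate (ℓ + m) b ≡ alternate ℓ (alternate m b)
  alternate-+ zero    m b = refl
  alternate-+ (suc ℓ) m b = cong not (alternate-+ ℓ m b)

  alternate-even : ∀ q b → alternate (q + q) b ≡ b
  alternate-even q b = trans (alternate-+ q q b) (twice q b)
    where
    twice : ∀ q b → alternate q (alternate q b) ≡ b
    twice zero    b = refl
    twice (suc q) b = trans (cong not (alternate-not q (alternate q b))) (trans (not-involutive _) (twice q b))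

  module Bipartition {n : ℕ} (G : Graph n) (col : Fin n → Bool) (proper : ∀ u v → adj G u v ≡ true → col u ≢ col v) where
    open Walks G

    inClass : Bool → Fin n → Bool
    inClass b v = does (col v Bool.≟ b)

    inClass-self : ∀ v → inClass (col v) v ≡ true
    inClass-self v = dec-true (col v Bool.≟ col v) refl

    neighbour-colour : ∀ v w → adj G v w ≡ true → col w ≡ not (col v)
    neighbour-colour v w vw = ¬-not (proper v w vw ∘ sym)

    walks-parity : ∀ ℓ u v → col v ≢ alternate ℓ (col u) → walks ℓ u v ≡ 0
    walks-parity zero    u v wrong with eqᵇ u v in u≟v
    ... | false = refl
    ... | true  = ⊥-elim (wrong (cong col (sym (eqᵇ-sound u≟v))))
    walks-parity (suc ℓ) u v wrong = sum-zero step
      where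
      step : ∀ w → A u w * walks ℓ w v ≡ 0
      step w with adj G u w in uw
      ... | false = refl
      ... | true  = trans (+-identityʳ (walks ℓ w v)) (walks-parity ℓ w v λ col-v →
                      wrong (trans col-v (trans (cong (alternate ℓ) (neighbour-colour u w uw)) (alternate-not ℓ (col u)))))

    classSize : Bool → ℕ
    classSize b = ∑[ v < n ] ⟦ inClass b v ⟧

    classSize-+ : ∀ b → classSize b + classSize (not b) ≡ n
    classSize-+ b = trans (sym (∑-distrib-+ (λ v → ⟦ inClass b v ⟧) _))
                          (trans (sum-cong-≗ (λ v → one-class (col v) b)) (sum-ones n))
      where
      one-class : ∀ c b → ⟦ does (c Bool.≟ b) ⟧ + ⟦ does (c Bool.≟ not b) ⟧ ≡ 1
      one-class true  true  = refl
      one-class true  false = refl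
      one-class false true  = refl
      one-class false false = refl

    module _ {k : ℕ} (reg : Regular G k) where

      -- Both sides count the edges between the two colour classes.
      classSize-balanced : ∀ b → classSize b * k ≡ classSize (not b) * k
      classSize-balanced b = begin
        classSize b * k
          ≡⟨ *-distribʳ-sum k (λ v → ⟦ inClass b v ⟧) ⟩
        ∑[ v < n ] (⟦ inClass b v ⟧ * k)
          ≡⟨ sum-cong-≗ (λ v → cong (⟦ inClass b v ⟧ *_) (sym (sum-A reg v))) ⟩
        ∑[ v < n ] (⟦ inClass b v ⟧ * sum (A v))
          ≡⟨ sum-cong-≗ (λ v → *-distribˡ-sum ⟦ inClass b v ⟧ (A v)) ⟩
        ∑[ v < n ] ∑[ w < n ] (⟦ inClass b v ⟧ * A v w)
          ≡⟨ sum-cong-≗ {n} (λ v → sum-cong-≗ λ w → edge v w) ⟩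
        ∑[ v < n ] ∑[ w < n ] (⟦ inClass (not b) w ⟧ * A w v)
          ≡⟨ ∑-comm (λ v w → ⟦ inClass (not b) w ⟧ * A w v) ⟩
        ∑[ w < n ] ∑[ v < n ] (⟦ inClass (not b) w ⟧ * A w v)
          ≡⟨ sum-cong-≗ (λ w → *-distribˡ-sum ⟦ inClass (not b) w ⟧ (A w)) ⟨
        ∑[ w < n ] (⟦ inClass (not b) w ⟧ * sum (A w))
          ≡⟨ sum-cong-≗ (λ w → cong (⟦ inClass (not b) w ⟧ *_) (sum-A reg w)) ⟩
        ∑[ w < n ] (⟦ inClass (not b) w ⟧ * k)
          ≡⟨ *-distribʳ-sum k (λ w → ⟦ inClass (not b) w ⟧) ⟨
        classSize (not b) * k ∎
        where
        open ≡-Reasoning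
        open NonBacktracking G using (sum-A)
        edge : ∀ v w → ⟦ inClass b v ⟧ * A v w ≡ ⟦ inClass (not b) w ⟧ * A w v
        edge v w with adj G v w in vw
        ... | false = trans (*-zeroʳ ⟦ inClass b v ⟧)
          (sym (trans (cong (λ a → ⟦ inClass (not b) w ⟧ * ⟦ a ⟧) (trans (adj-sym G w v) vw)) (*-zeroʳ ⟦ inClass (not b) w ⟧)))
        ... | true  = cong₂ (λ x a → ⟦ x ⟧ * ⟦ a ⟧) across (sym (trans (adj-sym G w v) vw))
          where
          ≟-not : ∀ c b → does (not c Bool.≟ not b) ≡ does (c Bool.≟ b)
          ≟-not true  true  = refl
          ≟-not true  false = refl
          ≟-not false true  = refl
          ≟-not false false = refl
          across : inClass b v ≡ inClass (not b) w
          across = trans (sym (≟-not (col v) b)) (cong (λ c → does (c Bool.≟ not b)) (sym (neighbour-colour v w vw)))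

      classSize-half : k ≢ 0 → ∀ b → 2 * classSize b ≡ n
      classSize-half k≢0 b = trans (cong (classSize b +_) (trans (+-identityʳ (classSize b))
                                     (*-cancelʳ-≡ (classSize b) (classSize (not b)) k {{≢-nonZero k≢0}} (classSize-balanced b))))
                                   (classSize-+ b)

  module OnClass {n : ℕ} (cls : Fin n → Bool) where

    Supported : (Fin n → ℕ) → Set
    Supported y = ∀ v → cls v ≡ false → y v ≡ 0

    size : ℕ
    size = ∑[ v < n ] ⟦ cls v ⟧

    sum-supported : ∀ y → Supported y → sum y ≡ ∑[ v < n ] (⟦ cls v ⟧ * y v)
    sum-supported y supp = sum-cong-≗ pointwise
      where
      pointwise : ∀ v → y v ≡ ⟦ cls v ⟧ * y v
      pointwise v with cls v in clsv
      ... | true  = sym (+-identityʳ (y v))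
      ... | false = supp v clsv

    supported-² : ∀ y → Supported y → Supported (λ v → y v * y v)
    supported-² y supp v clsv = cong (_* y v) (supp v clsv)

    cauchy-schwarz-supported : ∀ x → Supported x → sum x * sum x ≤ size * ∑[ v < n ] (x v * x v)
    cauchy-schwarz-supported x supp = subst₂ _≤_
      (sym (cong₂ _*_ (sum-supported x supp) (sum-supported x supp)))
      (sym (cong (size *_) (sum-supported (λ v → x v * x v) (supported-² x supp))))
      (cauchy-schwarz (λ v → ⟦ cls v ⟧) x)

    module _ (u : Fin n) (cls-u : cls u ≡ true) where

      others : Fin n → ℕ
      others v = ⟦ cls v ∧ not (eqᵇ u v) ⟧

      sum-split : ∀ y → Supported y → sum y ≡ y u + ∑[ v < n ] (others v * y v)
      sum-split y supp = begin
        sum y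
          ≡⟨ sum-cong-≗ pointwise ⟩
        ∑[ v < n ] (⟦ eqᵇ u v ⟧ * y v + others v * y v)
          ≡⟨ ∑-distrib-+ (λ v → ⟦ eqᵇ u v ⟧ * y v) (λ v → others v * y v) ⟩
        ∑[ v < n ] (⟦ eqᵇ u v ⟧ * y v) + ∑[ v < n ] (others v * y v)
          ≡⟨ cong (_+ ∑[ v < n ] (others v * y v)) (sum-δ u y) ⟩
        y u + ∑[ v < n ] (others v * y v) ∎
        where
        open ≡-Reasoning
        pointwise : ∀ v → y v ≡ ⟦ eqᵇ u v ⟧ * y v + others v * y v
        pointwise v with eqᵇ u v | cls v in clsv
        ... | true  | c     = sym (trans (cong (y v + 0 +_) (cong (λ b → ⟦ b ⟧ * y v) (∧-zeroʳ c)))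
                                          (trans (+-identityʳ (y v + 0)) (+-identityʳ (y v))))
        ... | false | true  = sym (+-identityʳ (y v))
        ... | false | false = supp v clsv

      size-split : size ≡ suc (sum others)
      size-split = trans (sum-split (λ v → ⟦ cls v ⟧) (λ v clsv → cong ⟦_⟧ clsv))
                         (cong₂ _+_ (cong ⟦_⟧ cls-u) (sum-cong-≗ λ v → others-idem (cls v) (not (eqᵇ u v))))
        where
        others-idem : ∀ a b → ⟦ a ∧ b ⟧ * ⟦ a ⟧ ≡ ⟦ a ∧ b ⟧
        others-idem true  true  = refl
        others-idem true  false = refl
        others-idem false b     = refl

      -- Cauchy–Schwarz on the class with u removed, (S − x u)² ≤ (size − 1)(Q − (x u)²), without subtraction.
      cauchy-schwarz-deleted : ∀ x → Supported x →
        let S = sum x ; Q = ∑[ v < n ] (x v * x v) in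
        Q + S * S + size * (x u * x u) ≤ size * Q + 2 * x u * S
      cauchy-schwarz-deleted x supp rewrite size-split | sum-split x supp | sum-split (λ v → x v * x v) (supported-² x supp) =
        subst₂ _≤_ (expand-lhs (x u) T₁ T₂ (sum others)) (expand-rhs (x u) T₁ T₂ (sum others))
               (+-monoʳ-≤ (common (x u) T₁ T₂ (sum others)) (cauchy-schwarz others x))
        where
        T₁ T₂ : ℕ
        T₁ = ∑[ v < n ] (others v * x v)
        T₂ = ∑[ v < n ] (others v * (x v * x v))
        common : ℕ → ℕ → ℕ → ℕ → ℕ
        common a t₁ t₂ m = 3 * (a * a) + m * (a * a) + t₂ + 2 * a * t₁
        expand-lhs : ∀ a t₁ t₂ m → (3 * (a * a) + m * (a * a) + t₂ + 2 * a * t₁) + t₁ * t₁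
                                   ≡ (a * a + t₂) + (a + t₁) * (a + t₁) + (1 + m) * (a * a)
        expand-lhs = solve-∀
        expand-rhs : ∀ a t₁ t₂ m → (3 * (a * a) + m * (a * a) + t₂ + 2 * a * t₁) + m * t₂
                                   ≡ (1 + m) * (a * a + t₂) + 2 * a * (a + t₁)
        expand-rhs = solve-∀

  module HalfGirth {n : ℕ} (G : Graph n) {k g λ′ : ℕ} (vgr : IsVGR G k g λ′) (h : ℕ) (g≡h+h : g ≡ h + h) where
    open Walks G
    open VGR G vgr

    row : Fin n → ℕ
    row = walks h vertex

    Q S D : ℕ
    Q = c g k + 2 * λ′
    S = k ^ h
    D = c h k

    row-sum : sum row ≡ S
    row-sum = sum-walks regular h vertex

    row-squares : ∑[ v < n ] (row v * row v) ≡ Q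
    row-squares = sum-walks²-half h g≡h+h vertex

    row-vertex : row vertex ≡ D
    row-vertex = closedWalks-short h (half<g h g≡h+h) vertex

    module _ (cls : Fin n → Bool) where
      open OnClass cls

      class-bound : cls vertex ≡ true → Supported row → Q + S * S + size * (D * D) ≤ size * Q + 2 * D * S
      class-bound cls-vertex supp =
        subst₂ (λ Q S → Q + S * S + size * (D * D) ≤ size * Q + 2 * D * S) row-squares row-sum
          (subst (λ D → Q₀ + S₀ * S₀ + size * (D * D) ≤ size * Q₀ + 2 * D * S₀) row-vertex
            (cauchy-schwarz-deleted vertex cls-vertex row supp))
        where
        Q₀ S₀ : ℕ
        Q₀ = ∑[ v < n ] (row v * row v)
        S₀ = sum row

      class-bound-cs : Supported row → S * S ≤ size * Q
      class-bound-cs supp = subst₂ (λ S Q → S * S ≤ size * Q) row-sum row-squares (cauchy-schwarz-supported row supp)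

    graph-bound : Q + S * S + n * (D * D) ≤ n * Q + 2 * D * S
    graph-bound = subst (λ N → Q + S * S + N * (D * D) ≤ N * Q + 2 * D * S) (sum-ones n)
                        (class-bound (λ _ → true) refl (λ _ ()))

    graph-bound-odd : ∀ q → h ≡ suc (q + q) → Q + S * S ≤ n * Q
    graph-bound-odd q h≡ = ≤-trans (m≤m+n (Q + S * S) (n * (D * D)))
      (subst (Q + S * S + n * (D * D) ≤_) (trans (cong (λ d → n * Q + 2 * d * S) D≡0) (+-identityʳ (n * Q))) graph-bound)
      where
      D≡0 : D ≡ 0
      D≡0 = treeWalks-odd k h 0 q (trans (+-identityʳ h) h≡)

    module _ (col : Fin n → Bool) (proper : ∀ u v → adj G u v ≡ true → col u ≢ col v) where
      open Bipartition G col proper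

      row-supported : ∀ b → alternate h (col vertex) ≡ b → OnClass.Supported (inClass b) row
      row-supported b alt≡b v not-in = walks-parity h vertex v λ col-v →
        true≢false (trans (sym (dec-true (col v Bool.≟ b) (trans col-v alt≡b))) not-in)

      half : ℕ
      half = classSize (col vertex)

      double-half : 2 * half ≡ n
      double-half = classSize-half regular k≢0 (col vertex)

      bipartite-bound-even : ∀ q → h ≡ q + q → Q + S * S + half * (D * D) ≤ half * Q + 2 * D * S
      bipartite-bound-even q h≡ = class-bound (inClass (col vertex)) (inClass-self vertex)
        (row-supported (col vertex) (trans (cong (λ ℓ → alternate ℓ (col vertex)) h≡) (alternate-even q (col vertex))))

      bipartite-bound-odd : ∀ q → h ≡ suc (q + q) → 2 * (S * S) ≤ n * Q
      bipartite-bound-odd q h≡ = subst (2 * (S * S) ≤_)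
        (trans (sym (*-assoc 2 (classSize (not (col vertex))) Q)) (cong (_* Q) (classSize-half regular k≢0 (not (col vertex)))))
        (*-monoʳ-≤ 2 (class-bound-cs (inClass (not (col vertex)))
          (row-supported (not (col vertex)) (trans (cong (λ ℓ → alternate ℓ (col vertex)) h≡)
                                                    (cong not (alternate-even q (col vertex)))))))

  halves : ∀ g h → g ≡ h + h → g / 2 ≡ h × g ≡ g / 2 + g / 2
  halves g h g≡h+h = g/2≡h , trans g≡h+h (sym (cong₂ _+_ g/2≡h g/2≡h))
    where
    g/2≡h : g / 2 ≡ h
    g/2≡h = trans (cong (_/ 2) (trans g≡h+h (double h))) (m*n/n≡m h 2)
      where
      double : ∀ h → h + h ≡ h * 2
      double = solve-∀

  girth≡0mod4 : ∀ g → g % 4 ≡ 0 → g / 2 ≡ g / 4 + g / 4 × g ≡ g / 2 + g / 2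
  girth≡0mod4 g g%4≡0 = halves g (g / 4 + g / 4)
    (trans (m≡m%n+[m/n]*n g 4) (trans (cong (_+ g / 4 * 4) g%4≡0) (quadruple (g / 4))))
    where
    quadruple : ∀ q → q * 4 ≡ (q + q) + (q + q)
    quadruple = solve-∀

  girth≡2mod4 : ∀ g → g % 4 ≡ 2 → g / 2 ≡ suc (g / 4 + g / 4) × g ≡ g / 2 + g / 2
  girth≡2mod4 g g%4≡2 = halves g (suc (g / 4 + g / 4))
    (trans (m≡m%n+[m/n]*n g 4) (trans (cong (_+ g / 4 * 4) g%4≡2) (quadruple+2 (g / 4))))
    where
    quadruple+2 : ∀ q → 2 + q * 4 ≡ suc (q + q) + suc (q + q)
    quadruple+2 = solve-∀

open import Data.Nat using (ℕ; _%_; _/_)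
import Data.Nat as ℕ
open import Data.Integer using (ℤ; +_; -_; _+_; _-_; _*_; _^_; _≤_; +≤+)
open import Data.Integer.Properties using (pos-+; pos-*; ^-distribˡ-+-*; +-monoˡ-≤; *-monoˡ-≤-nonNeg; *-assoc)
open import Data.Integer.Tactic.RingSolver using (solve-∀)
open import Data.Product using (_×_; _,_; proj₁; proj₂)
open import Relation.Binary.PropositionalEquality using (_≡_; refl; sym; trans; cong; cong₂; subst; subst₂)
open Counting
  using (sum-ones; girth≡0mod4; girth≡2mod4; alternate; alternate-even; treeWalks-odd; module HalfGirth)

pos-^ : ∀ k h → + (k ℕ.^ h) ≡ (+ k) ^ h
pos-^ k ℕ.zero    = refl
pos-^ k (ℕ.suc h) = trans (pos-* k (k ℕ.^ h)) (cong (λ z → + k * z) (pos-^ k h))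

pos-square : ∀ k g h → g ≡ h ℕ.+ h → (+ k) ^ g ≡ + (k ℕ.^ h) * + (k ℕ.^ h)
pos-square k g h g≡h+h =
  trans (cong ((+ k) ^_) g≡h+h) (trans (^-distribˡ-+-* (+ k) h h) (sym (cong₂ _*_ (pos-^ k h) (pos-^ k h))))

pos-+2* : ∀ C L → + C + + 2 * + L ≡ + (C ℕ.+ 2 ℕ.* L)
pos-+2* C L = sym (trans (pos-+ C (2 ℕ.* L)) (cong (λ z → + C + z) (pos-* 2 L)))

-- Q + S² + N D² ≤ N Q + 2 D S is the subtraction-free form of Q + S² − 2 D S ≤ N (Q − D²).
lift-bound : ∀ {C L : ℤ} {Q S D N : ℕ} → C + + 2 * L ≡ + Q →
  Q ℕ.+ S ℕ.* S ℕ.+ N ℕ.* (D ℕ.* D) ℕ.≤ N ℕ.* Q ℕ.+ 2 ℕ.* D ℕ.* S →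
  C + + 2 * L + + S * + S - + 2 * + D * + S ≤ + N * (C - (+ D) ^ 2 + + 2 * L)
lift-bound {C} {L} {Q} {S} {D} {N} C+2L≡Q bound =
  subst₂ _≤_ (lhs C L (+ D) (+ N) (+ S)) (rhs C L (+ D) (+ N) (+ S))
    (+-monoˡ-≤ (- (+ N * (+ D * + D) + + 2 * + D * + S)) (subst₂ _≤_ cast-lhs cast-rhs (+≤+ bound)))
  where
  cast-lhs : + (Q ℕ.+ S ℕ.* S ℕ.+ N ℕ.* (D ℕ.* D)) ≡ C + + 2 * L + + S * + S + + N * (+ D * + D)
  cast-lhs = trans (pos-+ (Q ℕ.+ S ℕ.* S) (N ℕ.* (D ℕ.* D)))
    (cong₂ _+_ (trans (pos-+ Q (S ℕ.* S)) (cong₂ _+_ (sym C+2L≡Q) (pos-* S S)))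
               (trans (pos-* N (D ℕ.* D)) (cong (λ z → + N * z) (pos-* D D))))
  cast-rhs : + (N ℕ.* Q ℕ.+ 2 ℕ.* D ℕ.* S) ≡ + N * (C + + 2 * L) + + 2 * + D * + S
  cast-rhs = trans (pos-+ (N ℕ.* Q) (2 ℕ.* D ℕ.* S))
    (cong₂ _+_ (trans (pos-* N Q) (cong (λ z → + N * z) (sym C+2L≡Q)))
               (trans (pos-* (2 ℕ.* D) S) (cong (_* + S) (pos-* 2 D))))
  lhs : ∀ a b d m s → a + + 2 * b + s * s + m * (d * d) - (m * (d * d) + + 2 * d * s) ≡ a + + 2 * b + s * s - + 2 * d * s
  lhs = solve-∀
  rhs : ∀ a b d m s → m * (a + + 2 * b) + + 2 * d * s - (m * (d * d) + + 2 * d * s) ≡ m * (a - d * (d * + 1) + + 2 * b)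
  rhs = solve-∀

lift-bound-odd : ∀ {C L : ℤ} {Q S N : ℕ} → C + + 2 * L ≡ + Q → Q ℕ.+ S ℕ.* S ℕ.≤ N ℕ.* Q →
  C + + 2 * L + + S * + S ≤ + N * (C + + 2 * L)
lift-bound-odd {C} {L} {Q} {S} {N} C+2L≡Q bound = subst₂ _≤_
  (trans (pos-+ Q (S ℕ.* S)) (cong₂ _+_ (sym C+2L≡Q) (pos-* S S)))
  (trans (pos-* N Q) (cong (λ z → + N * z) (sym C+2L≡Q)))
  (+≤+ bound)

doubled : ∀ {A B : ℤ} {N n : ℕ} → 2 ℕ.* N ≡ n → A ≤ + N * B → + 2 * A ≤ + n * B
doubled {A} {B} {N} 2N≡n A≤NB = subst (λ z → + 2 * A ≤ z)
  (trans (sym (*-assoc (+ 2) (+ N) B)) (cong (_* B) (trans (sym (pos-* 2 N)) (cong +_ 2N≡n))))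
  (*-monoˡ-≤-nonNeg (+ 2) A≤NB)

module _ {k g λ′ : ℕ} where

  module _ (g%4≡0 : g % 4 ≡ 0) where

    private
      h : ℕ
      h = g / 2
      h≡ : h ≡ g / 4 ℕ.+ g / 4
      h≡ = proj₁ (girth≡0mod4 g g%4≡0)
      g≡h+h : g ≡ h ℕ.+ h
      g≡h+h = proj₂ (girth≡0mod4 g g%4≡0)

    bound-0mod4 : ∀ n (G : Graph n) → IsVGR G k g λ′ →
      (+ c g k) + + 2 * + λ′ + (+ k) ^ g - + 2 * (+ c (g / 2) k) * (+ k) ^ (g / 2)
        ≤ + n * ((+ c g k) - (+ c (g / 2) k) ^ 2 + + 2 * + λ′)
    bound-0mod4 n G vgr =
      subst₂ (λ K Kh → + c g k + + 2 * + λ′ + K - + 2 * + c h k * Kh ≤ + n * (+ c g k - (+ c h k) ^ 2 + + 2 * + λ′))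
        (sym (pos-square k g h g≡h+h)) (pos-^ k h)
        (lift-bound {+ c g k} {+ λ′} {Q} {S} {D} {n} (pos-+2* (c g k) λ′) graph-bound)
      where open HalfGirth G vgr h g≡h+h

    bound-0mod4-bipartite : ∀ n (G : Graph n) → Bipartite G → IsVGR G k g λ′ →
      + 2 * ((+ c g k) + + 2 * + λ′ + (+ k) ^ g - + 2 * (+ c (g / 2) k) * (+ k) ^ (g / 2))
        ≤ + n * ((+ c g k) - (+ c (g / 2) k) ^ 2 + + 2 * + λ′)
    bound-0mod4-bipartite n G (col , proper) vgr =
      subst₂ (λ K Kh → + 2 * (+ c g k + + 2 * + λ′ + K - + 2 * + c h k * Kh) ≤ + n * (+ c g k - (+ c h k) ^ 2 + + 2 * + λ′))
        (sym (pos-square k g h g≡h+h)) (pos-^ k h)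
        (doubled {N = half col proper} (double-half col proper)
          (lift-bound {+ c g k} {+ λ′} {Q} {S} {D} {half col proper} (pos-+2* (c g k) λ′)
                      (bipartite-bound-even col proper (g / 4) h≡)))
      where open HalfGirth G vgr h g≡h+h

  module _ (g%4≡2 : g % 4 ≡ 2) where

    private
      h : ℕ
      h = g / 2
      h≡ : h ≡ ℕ.suc (g / 4 ℕ.+ g / 4)
      h≡ = proj₁ (girth≡2mod4 g g%4≡2)
      g≡h+h : g ≡ h ℕ.+ h
      g≡h+h = proj₂ (girth≡2mod4 g g%4≡2)

    bound-2mod4 : ∀ n (G : Graph n) → IsVGR G k g λ′ →
      (+ c g k) + + 2 * + λ′ + (+ k) ^ g ≤ + n * ((+ c g k) + + 2 * + λ′)
    bound-2mod4 n G vgr =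
      subst (λ K → + c g k + + 2 * + λ′ + K ≤ + n * (+ c g k + + 2 * + λ′)) (sym (pos-square k g h g≡h+h))
        (lift-bound-odd {+ c g k} {+ λ′} {Q} {S} {n} (pos-+2* (c g k) λ′) (graph-bound-odd (g / 4) h≡))
      where open HalfGirth G vgr h g≡h+h

    bound-2mod4-bipartite : ∀ n (G : Graph n) → Bipartite G → IsVGR G k g λ′ →
      + 2 * (+ k) ^ g ≤ + n * ((+ c g k) + + 2 * + λ′)
    bound-2mod4-bipartite n G (col , proper) vgr =
      subst₂ _≤_
        (trans (pos-* 2 (S ℕ.* S)) (cong (λ z → + 2 * z) (trans (pos-* S S) (sym (pos-square k g h g≡h+h)))))
        (trans (pos-* n Q) (cong (λ z → + n * z) (sym (pos-+2* (c g k) λ′))))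
        (+≤+ (bipartite-bound-odd col proper (g / 4) h≡))
      where open HalfGirth G vgr h g≡h+h

theorem9 : (k g λ′ : ℕ) →
    ((g % 4 ≡ 0) →
      ((n : ℕ) (G : Graph n) → IsVGR G k g λ′ →
        ((+ c g k) + + 2 * + λ′ + (+ k) ^ g - + 2 * (+ c (g / 2) k) * (+ k) ^ (g / 2))
          ≤ + n * ((+ c g k) - (+ c (g / 2) k) ^ 2 + + 2 * + λ′))
      × ((n : ℕ) (G : Graph n) → Bipartite G → IsVGR G k g λ′ →
        + 2 * ((+ c g k) + + 2 * + λ′ + (+ k) ^ g - + 2 * (+ c (g / 2) k) * (+ k) ^ (g / 2))
          ≤ + n * ((+ c g k) - (+ c (g / 2) k) ^ 2 + + 2 * + λ′)))
    × ((g % 4 ≡ 2) →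
      ((n : ℕ) (G : Graph n) → IsVGR G k g λ′ →
        ((+ c g k) + + 2 * + λ′ + (+ k) ^ g) ≤ + n * ((+ c g k) + + 2 * + λ′))
      × ((n : ℕ) (G : Graph n) → Bipartite G → IsVGR G k g λ′ →
        + 2 * (+ k) ^ g ≤ + n * ((+ c g k) + + 2 * + λ′)))
theorem9 k g λ′ =
  (λ g%4≡0 → bound-0mod4 g%4≡0 , bound-0mod4-bipartite g%4≡0) ,
  (λ g%4≡2 → bound-2mod4 g%4≡2 , bound-2mod4-bipartite g%4≡2)
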